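{- For every variable $i$ and every HF formula $A$, $\emptyset \vdash \mathrm{KRP}(\ulcorner x_i\urcorner, \ulcorner A\urcorner, \ulcorner A(i:=\ulcorner A\urcorner)\urcorner)$ holds in the HF calculus, where $x_i$ is the variable $i$ regarded as a term.
   Context: The HF calculus is the following first-order theory. Its language has a constant $0$, a binary function symbol $\lhd$, a binary relation symbol $\in$, and equality. It has the propositional, equality and quantifier axioms, together with the axioms $z=0 \leftrightarrow \forall x\,(x\notin z)$ and $z = x\lhd y \leftrightarrow \forall u\,(u\in z \leftrightarrow u\in x \vee u=y)$. It also has the induction schema $\phi(0)\wedge \forall x y(\phi(x)\wedge\phi(y)\to\phi(x\lhd y)) \to \forall x\,\phi(x)$, a fixed additional sentence true in the standard model of hereditarily finite sets, modus ponens, and the existential rule. $H\vdash A$ denotes derivability from hypotheses $H$. $\ulcorner\cdot\urcorner$ is the Gödel coding of terms and formulas into variable-free terms denoting hereditarily finite sets, with bound variables coded by de Bruijn indices. $A(i:=t)$ denotes capture-avoiding substitution of $t$ for $i$ in $A$. $\mathrm{KRP}(v,x,y)$ is the HF formula, a $\Sigma$ formula, that formalises coded substitution. It expresses that $y$ is the code of the formula coded by $x$ in which the variable coded by $v$ has been replaced by the term $x$, that is, by the code of that formula's own code. -}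

module Defs where

open import Data.Nat using (ℕ; zero; suc; _+_; _^_; _<_; _≡ᵇ_; ⌊_/2⌋)
open import Data.Bool using (Bool; true; false; not; if_then_else_)
open import Data.List using (List; []; _∷_)
open import Data.Product using (Σ; _×_)
open import Data.Sum using (_⊎_)
open import Data.Empty using (⊥)
open import Data.Unit using (⊤)
open import Relation.Binary.PropositionalEquality using (_≡_)
open import Relation.Nullary using (¬_)

-- Syntax of the HF calculus (locally nameless):
--   free variables  var i  (i : ℕ is the variable x_i),
--   bound variables bnd k  (de Bruijn indices, bound by ex).
-- An "HF formula" is a locally closed Fm (see LC below).

data Tm : Set where
  zer  : Tm
  var  : ℕ → Tm
  bnd  : ℕ → Tm
  eats : Tm → Tm → Tm

data Fm : Set where
  mem  : Tm → Tm → Fm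
  eq   : Tm → Tm → Fm
  disj : Fm → Fm → Fm
  neg  : Fm → Fm
  ex   : Fm → Fm

infixr 4 _⇒_
infixr 5 _∨F_
infixr 6 _∧F_

_∨F_ : Fm → Fm → Fm
A ∨F B = disj A B

_⇒_ : Fm → Fm → Fm
A ⇒ B = disj (neg A) B

_∧F_ : Fm → Fm → Fm
A ∧F B = neg (disj (neg A) (neg B))

_⇔_ : Fm → Fm → Fm
A ⇔ B = (A ⇒ B) ∧F (B ⇒ A)

allF : Fm → Fm
allF A = neg (ex (neg A))

lcT : ℕ → Tm → Set
lcT d zer        = ⊤
lcT d (var i)    = ⊤
lcT d (bnd k)    = k < d
lcT d (eats t u) = lcT d t × lcT d u

lcF : ℕ → Fm → Set
lcF d (mem t u)  = lcT d t × lcT d u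
lcF d (eq t u)   = lcT d t × lcT d u
lcF d (disj A B) = lcF d A × lcF d B
lcF d (neg A)    = lcF d A
lcF d (ex A)     = lcF (suc d) A

LC : Fm → Set
LC = lcF 0

occT : ℕ → Tm → Bool
occT i zer        = false
occT i (var j)    = i ≡ᵇ j
occT i (bnd k)    = false
occT i (eats t u) = if occT i t then true else occT i u

occF : ℕ → Fm → Bool
occF i (mem t u)  = if occT i t then true else occT i u
occF i (eq t u)   = if occT i t then true else occT i u
occF i (disj A B) = if occF i A then true else occF i B
occF i (neg A)    = occF i A
occF i (ex A)     = occF i A

Fresh : ℕ → Fm → Set
Fresh i A = occF i A ≡ false

-- Substitution of a term for a free variable: A(i:=t).
-- (Capture-avoiding: bound variables are de Bruijn indices, so
-- nothing can be captured as long as t is locally closed.)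

substσT : (ℕ → Tm) → Tm → Tm
substσT σ zer        = zer
substσT σ (var j)    = σ j
substσT σ (bnd k)    = bnd k
substσT σ (eats t u) = eats (substσT σ t) (substσT σ u)

substσF : (ℕ → Tm) → Fm → Fm
substσF σ (mem t u)  = mem (substσT σ t) (substσT σ u)
substσF σ (eq t u)   = eq (substσT σ t) (substσT σ u)
substσF σ (disj A B) = disj (substσF σ A) (substσF σ B)
substσF σ (neg A)    = neg (substσF σ A)
substσF σ (ex A)     = ex (substσF σ A)

single : ℕ → Tm → ℕ → Tm
single i t j = if i ≡ᵇ j then t else var j

_[_≔_] : Fm → ℕ → Tm → Fm
A [ i ≔ t ] = substσF (single i t) A

openT : ℕ → Tm → Tm → Tm
openT d t zer        = zer
openT d t (var j)    = var j
openT d t (bnd k)    = if d ≡ᵇ k then t else bnd k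
openT d t (eats a b) = eats (openT d t a) (openT d t b)

openF : ℕ → Tm → Fm → Fm
openF d t (mem a b)  = mem (openT d t a) (openT d t b)
openF d t (eq a b)   = eq (openT d t a) (openT d t b)
openF d t (disj A B) = disj (openF d t A) (openF d t B)
openF d t (neg A)    = neg (openF d t A)
openF d t (ex A)     = ex (openF (suc d) t A)

inst : Fm → Tm → Fm
inst φ t = openF 0 t φ

closeT : ℕ → ℕ → Tm → Tm
closeT d x zer        = zer
closeT d x (var j)    = if x ≡ᵇ j then bnd d else var j
closeT d x (bnd k)    = bnd k
closeT d x (eats a b) = eats (closeT d x a) (closeT d x b)

closeF : ℕ → ℕ → Fm → Fm
closeF d x (mem a b)  = mem (closeT d x a) (closeT d x b)
closeF d x (eq a b)   = eq (closeT d x a) (closeT d x b)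
closeF d x (disj A B) = disj (closeF d x A) (closeF d x B)
closeF d x (neg A)    = neg (closeF d x A)
closeF d x (ex A)     = ex (closeF (suc d) x A)

exN : ℕ → Fm → Fm
exN x A = ex (closeF 0 x A)

allN : ℕ → Fm → Fm
allN x A = neg (exN x (neg A))

-- The standard model of hereditarily finite sets (Ackermann coding on ℕ:
-- a ∈ b iff bit a of b is 1), used only to say that the extra axiom
-- is true in the standard model.

oddᵇ : ℕ → Bool
oddᵇ zero    = false
oddᵇ (suc n) = not (oddᵇ n)

bit : ℕ → ℕ → Bool
bit zero    m = oddᵇ m
bit (suc n) m = bit n ⌊ m /2⌋

_∈ᴴ_ : ℕ → ℕ → Set
a ∈ᴴ b = bit a b ≡ true

eatsᴴ : ℕ → ℕ → ℕ
eatsᴴ b a = if bit a b then b else b + 2 ^ a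

lookupD : List ℕ → ℕ → ℕ
lookupD []       k       = 0
lookupD (a ∷ as) zero    = a
lookupD (a ∷ as) (suc k) = lookupD as k

evalT : (ℕ → ℕ) → List ℕ → Tm → ℕ
evalT ρ β zer        = 0
evalT ρ β (var i)    = ρ i
evalT ρ β (bnd k)    = lookupD β k
evalT ρ β (eats t u) = eatsᴴ (evalT ρ β t) (evalT ρ β u)

Sat : (ℕ → ℕ) → List ℕ → Fm → Set
Sat ρ β (mem t u)  = evalT ρ β t ∈ᴴ evalT ρ β u
Sat ρ β (eq t u)   = evalT ρ β t ≡ evalT ρ β u
Sat ρ β (disj A B) = Sat ρ β A ⊎ Sat ρ β B
Sat ρ β (neg A)    = ¬ Sat ρ β A
Sat ρ β (ex A)     = Σ ℕ (λ a → Sat ρ (a ∷ β) A)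

Sentence : Fm → Set
Sentence A = LC A × ((i : ℕ) → Fresh i A)

TrueHF : Fm → Set
TrueHF A = Sat (λ _ → 0) [] A

v : ℕ → Tm
v = var

data Axiom (E : Fm) : Fm → Set where
  extra     : Axiom E E
  ident     : ∀ A → Axiom E (A ⇒ A)
  disjI1    : ∀ A B → Axiom E (A ⇒ (A ∨F B))
  disjCont  : ∀ A → Axiom E ((A ∨F A) ⇒ A)
  disjAssoc : ∀ A B C → Axiom E ((A ∨F (B ∨F C)) ⇒ ((A ∨F B) ∨F C))
  disjConj  : ∀ A B C → Axiom E ((C ∨F A) ⇒ ((neg C ∨F B) ⇒ (A ∨F B)))
  reflAx    : Axiom E (eq (v 0) (v 0))
  eqCong    : Axiom E ((eq (v 0) (v 1) ∧F eq (v 2) (v 3)) ⇒ (eq (v 0) (v 2) ⇒ eq (v 1) (v 3)))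
  memCong   : Axiom E ((eq (v 0) (v 1) ∧F eq (v 2) (v 3)) ⇒ (mem (v 0) (v 2) ⇒ mem (v 1) (v 3)))
  eatsCong  : Axiom E ((eq (v 0) (v 1) ∧F eq (v 2) (v 3)) ⇒ eq (eats (v 0) (v 2)) (eats (v 1) (v 3)))
  spec      : ∀ A t → lcT 0 t → Axiom E (inst A t ⇒ ex A)
  hf1       : Axiom E (eq (v 0) zer ⇔ allN 1 (neg (mem (v 1) (v 0))))
  hf2       : Axiom E (eq (v 0) (eats (v 1) (v 2))
                ⇔ allN 3 (mem (v 3) (v 0) ⇔ (mem (v 3) (v 1) ∨F eq (v 3) (v 2))))
  induct    : ∀ φ x y → ¬ (x ≡ y) → Fresh x φ → Fresh y φ →
              Axiom E ((inst φ zer ∧F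
                        allN x (allN y ((inst φ (v x) ∧F inst φ (v y)) ⇒ inst φ (eats (v x) (v y)))))
                       ⇒ allF φ)

data Deriv (E : Fm) (H : Fm → Set) : Fm → Set where
  hyp    : ∀ {A} → H A → Deriv E H A
  axm    : ∀ {A} → Axiom E A → LC A → Deriv E H A
  mp     : ∀ {A B} → Deriv E H (A ⇒ B) → Deriv E H A → Deriv E H B
  exists : ∀ {A B} i → Deriv E H (inst A (v i) ⇒ B) →
           Fresh i A → Fresh i B → (∀ C → H C → Fresh i C) →
           Deriv E H (ex A ⇒ B)

∅ : Fm → Set
∅ _ = ⊥

hpair : Tm → Tm → Tm
hpair a b = eats (eats zer (eats zer a)) (eats (eats zer a) b)   -- {{a},{a,b}}

htuple : ℕ → Tm
htuple zero    = hpair zer zer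
htuple (suc n) = hpair zer (htuple n)

ordT : ℕ → Tm
ordT zero    = zer
ordT (suc n) = eats (ordT n) (ordT n)

qEats qMem qEq qDisj : Tm → Tm → Tm
qEats a b = hpair (htuple 1) (hpair a b)
qMem  a b = hpair (htuple 0) (hpair a b)
qEq   a b = hpair (htuple 2) (hpair a b)
qDisj a b = hpair (htuple 3) (hpair a b)

qNeg qEx : Tm → Tm
qNeg a = hpair (htuple 4) a
qEx  a = hpair (htuple 5) a

⌜_⌝T : Tm → Tm
⌜ zer ⌝T      = zer
⌜ var i ⌝T    = ordT (suc i)
⌜ bnd k ⌝T    = hpair (htuple 6) (ordT k)
⌜ eats t u ⌝T = qEats ⌜ t ⌝T ⌜ u ⌝T

⌜_⌝F : Fm → Tm
⌜ mem t u ⌝F  = qMem ⌜ t ⌝T ⌜ u ⌝T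
⌜ eq t u ⌝F   = qEq ⌜ t ⌝T ⌜ u ⌝T
⌜ disj A B ⌝F = qDisj ⌜ A ⌝F ⌜ B ⌝F
⌜ neg A ⌝F    = qNeg ⌜ A ⌝F
⌜ ex A ⌝F     = qEx ⌜ A ⌝F

-- Convention: each builder takes a counter k such that all variables
-- occurring in its term arguments are < k; it uses x_k, x_{k+1}, ...
-- for its own (quantified) variables.

ex∈ : ℕ → Tm → Fm → Fm
ex∈ n t B = exN n (mem (v n) t ∧F B)

all∈ : ℕ → Tm → Fm → Fm
all∈ n t B = allN n (mem (v n) t ⇒ B)

OrdP : ℕ → Tm → Fm
OrdP k x = all∈ k x (all∈ (k + 1) (v k) (mem (v (k + 1)) x))
        ∧F all∈ k x (all∈ (k + 1) (v k) (all∈ (k + 2) (v (k + 1)) (mem (v (k + 2)) (v k))))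

-- base case of term substitution: a is an atomic term code, b is its
-- image when the variable coded by w is replaced by the term coded by u
TermBaseP : ℕ → Tm → Tm → Tm → Tm → Fm
TermBaseP k w u a b =
     (eq a zer ∧F eq b zer)
  ∨F (eq a w ∧F eq b u)
  ∨F (OrdP k a ∧F neg (eq a zer) ∧F neg (eq a w) ∧F eq b a)
  ∨F exN k (OrdP (k + 1) (v k) ∧F eq a (hpair (htuple 6) (v k)) ∧F eq b a)

-- Witnessed by a finite set S of pairs ⟨a,b⟩, each justified by
-- members of S (well-founded since codes have smaller rank).
SubstTermP : ℕ → Tm → Tm → Tm → Tm → Fm
SubstTermP k w u t t' =
  exN S (mem (hpair t t') (v S) ∧F
    all∈ P (v S) (exN a (exN b (eq (v P) (hpair (v a) (v b)) ∧F
      (TermBaseP (k + 8) w u (v a) (v b)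
       ∨F exN a1 (exN b1 (exN a2 (exN b2
            (mem (hpair (v a1) (v b1)) (v S) ∧F mem (hpair (v a2) (v b2)) (v S)
             ∧F eq (v a) (qEats (v a1) (v a2)) ∧F eq (v b) (qEats (v b1) (v b2)))))))))))
  where
  S = k ; P = k + 1 ; a = k + 2 ; b = k + 3
  a1 = k + 4 ; b1 = k + 5 ; a2 = k + 6 ; b2 = k + 7

SubstFormP : ℕ → Tm → Tm → Tm → Tm → Fm
SubstFormP k w u x y =
  exN S (mem (hpair x y) (v S) ∧F
    all∈ P (v S) (exN a (exN b (eq (v P) (hpair (v a) (v b)) ∧F
      (atomic qMem ∨F atomic qEq
       ∨F exN a1 (exN b1 (exN a2 (exN b2
            (mem (hpair (v a1) (v b1)) (v S) ∧F mem (hpair (v a2) (v b2)) (v S)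
             ∧F eq (v a) (qDisj (v a1) (v a2)) ∧F eq (v b) (qDisj (v b1) (v b2))))))
       ∨F exN a1 (exN b1 (mem (hpair (v a1) (v b1)) (v S)
             ∧F eq (v a) (qNeg (v a1)) ∧F eq (v b) (qNeg (v b1))))
       ∨F exN a1 (exN b1 (mem (hpair (v a1) (v b1)) (v S)
             ∧F eq (v a) (qEx (v a1)) ∧F eq (v b) (qEx (v b1)))))))))
  where
  S = k ; P = k + 1 ; a = k + 2 ; b = k + 3
  a1 = k + 4 ; b1 = k + 5 ; a2 = k + 6 ; b2 = k + 7
  atomic : (Tm → Tm → Tm) → Fm
  atomic q = exN a1 (exN b1 (exN a2 (exN b2
      (eq (v a) (q (v a1) (v a2)) ∧F eq (v b) (q (v b1) (v b2))
       ∧F SubstTermP (k + 8) w u (v a1) (v b1) ∧F SubstTermP (k + 8) w u (v a2) (v b2)))))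

QuoteP : ℕ → Tm → Tm → Fm
QuoteP k x z =
  exN S (mem (hpair x z) (v S) ∧F
    all∈ P (v S) (exN a (exN b (eq (v P) (hpair (v a) (v b)) ∧F
      ((eq (v a) zer ∧F eq (v b) zer)
       ∨F exN a1 (exN b1 (exN a2 (exN b2
            (mem (hpair (v a1) (v b1)) (v S) ∧F mem (hpair (v a2) (v b2)) (v S)
             ∧F eq (v a) (eats (v a1) (v a2)) ∧F eq (v b) (qEats (v b1) (v b2)))))))))))
  where
  S = k ; P = k + 1 ; a = k + 2 ; b = k + 3
  a1 = k + 4 ; b1 = k + 5 ; a2 = k + 6 ; b2 = k + 7

-- KRP(v,x,y) with free variables x_0 = v, x_1 = x, x_2 = y:
--   ∃z (Quote(x,z) ∧ SubstForm(v,z,x,y))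
KRPfm : Fm
KRPfm = exN 3 (QuoteP 4 (v 1) (v 3) ∧F SubstFormP 4 (v 0) (v 3) (v 1) (v 2))

krpσ : Tm → Tm → Tm → ℕ → Tm
krpσ a b c zero                = a
krpσ a b c (suc zero)          = b
krpσ a b c (suc (suc zero))    = c
krpσ a b c (suc (suc (suc n))) = var (suc (suc (suc n)))

KRP : Tm → Tm → Tm → Fm
KRP a b c = substσF (krpσ a b c) KRPfm

-- KRP(⌜x_i⌝, ⌜A⌝, ⌜A(i:=⌜A⌝)⌝) is a Σ sentence, so it is proved by exhibiting its witnesses.
-- Quote, SubstTerm and SubstForm each assert a finite set S of pairs containing the pair in question
-- and closed under their defining clauses. We take for S the explicit HF term listing the pairs
-- ⟨s, ⌜s⌝⟩ for the subterms s of ⌜A⌝, resp. ⟨⌜s⌝, ⌜s(i:=⌜A⌝)⌝⟩ for the subterms s of a term of A,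
-- resp. ⟨⌜B⌝, ⌜B(i:=⌜A⌝)⌝⟩ for the subformulas B of A. Every clause is then witnessed by the pairs of
-- the immediate constituents, which lie in S, and by reflexivity of equality; the ◁ axiom turns
-- membership in S into a finite disjunction of equalities. The only set-theoretic facts needed are
-- that the codes ⌜x_j⌝ = {0, …, j} of variables are nonzero ordinals and pairwise distinct, the latter
-- because no ordinal is a member of itself.

module Submission where

open import Defs
open import Data.Bool using (Bool; true; false; if_then_else_; T)
open import Data.Empty using (⊥; ⊥-elim)
open import Data.List using (List; []; _∷_; _++_; map)
open import Data.List.Membership.Propositional using (_∈_)
open import Data.List.Membership.Propositional.Properties using (∈-++⁺ˡ; ∈-++⁺ʳ; ∈-++⁻; ∈-map⁺; ∈-map⁻)
open import Data.List.Relation.Unary.All using (All; []; _∷_; lookup)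
open import Data.List.Relation.Unary.Any using (here; there)
open import Data.Nat using (ℕ; zero; suc; _+_; _<_; _≤_; _≡ᵇ_; s≤s; _⊔_; _<?_)
open import Data.Nat.Properties
  using (≡ᵇ⇒≡; _≟_; suc-injective; +-cancelˡ-≡; m+1+n≢m; m⊔n≤o⇒m≤o; m⊔n≤o⇒n≤o;
         ≤-refl; m≤n⇒m≤1+n; m≤n⇒m<n∨m≡n; <-trans; <-cmp)
open import Data.Product using (_×_; _,_; proj₁; proj₂)
open import Data.Sum using (inj₁; inj₂)
open import Data.Unit using (⊤; tt)
open import Function using (id; const)
open import Relation.Binary.Definitions using (tri<; tri≈; tri>)
open import Relation.Binary.PropositionalEquality
open import Relation.Nullary using (Dec; yes; no)
open import Relation.Nullary.Decidable using (True; toWitness; _×-dec_)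

≡ᵇ-refl : ∀ n → (n ≡ᵇ n) ≡ true
≡ᵇ-refl zero    = refl
≡ᵇ-refl (suc n) = ≡ᵇ-refl n

≡ᵇ-true⇒≡ : ∀ m n → (m ≡ᵇ n) ≡ true → m ≡ n
≡ᵇ-true⇒≡ m n e = ≡ᵇ⇒≡ m n (subst T (sym e) tt)

<⇒≡ᵇ-false : ∀ {k d} → k < d → (d ≡ᵇ k) ≡ false
<⇒≡ᵇ-false {zero}  {suc d} _       = refl
<⇒≡ᵇ-false {suc k} {suc d} (s≤s p) = <⇒≡ᵇ-false p

≢⇒≡ᵇ-false : ∀ m n → m ≢ n → (m ≡ᵇ n) ≡ false
≢⇒≡ᵇ-false m n m≢n with m ≡ᵇ n in e
... | true  = ⊥-elim (m≢n (≡ᵇ-true⇒≡ m n e))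
... | false = refl

-- Substitutions, opening and closing

_[_↦_] : (ℕ → Tm) → ℕ → Tm → ℕ → Tm
(σ [ x ↦ t ]) j = if x ≡ᵇ j then t else σ j

_[_≔_]T : Tm → ℕ → Tm → Tm
t [ i ≔ u ]T = substσT (single i u) t

upd-same : ∀ σ x t → (σ [ x ↦ t ]) x ≡ t
upd-same σ x t rewrite ≡ᵇ-refl x = refl

upd-other : ∀ σ {x y} t → x ≢ y → (σ [ x ↦ t ]) y ≡ σ y
upd-other σ {x} {y} t x≢y rewrite ≢⇒≡ᵇ-false x y x≢y = refl

upd-var-self : ∀ x j → (var [ x ↦ var x ]) j ≡ var j
upd-var-self x j with x ≡ᵇ j in e
... | true  = cong var (≡ᵇ-true⇒≡ x j e)
... | false = refl

LCSubst : (ℕ → Tm) → Set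
LCSubst σ = ∀ j → lcT 0 (σ j)

LCSubst-var : LCSubst var
LCSubst-var j = tt

LCSubst-upd : ∀ {σ} x {t} → LCSubst σ → lcT 0 t → LCSubst (σ [ x ↦ t ])
LCSubst-upd x l lt j with x ≡ᵇ j
... | true  = lt
... | false = l j

substσT-cong : ∀ {σ τ} → (∀ j → σ j ≡ τ j) → ∀ u → substσT σ u ≡ substσT τ u
substσT-cong e zer        = refl
substσT-cong e (var j)    = e j
substσT-cong e (bnd k)    = refl
substσT-cong e (eats a b) = cong₂ eats (substσT-cong e a) (substσT-cong e b)

substσF-cong : ∀ {σ τ} → (∀ j → σ j ≡ τ j) → ∀ φ → substσF σ φ ≡ substσF τ φ
substσF-cong e (mem a b)  = cong₂ mem (substσT-cong e a) (substσT-cong e b)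
substσF-cong e (eq a b)   = cong₂ eq (substσT-cong e a) (substσT-cong e b)
substσF-cong e (disj A B) = cong₂ disj (substσF-cong e A) (substσF-cong e B)
substσF-cong e (neg A)    = cong neg (substσF-cong e A)
substσF-cong e (ex A)     = cong ex (substσF-cong e A)

substσT-id : ∀ u → substσT var u ≡ u
substσT-id zer        = refl
substσT-id (var j)    = refl
substσT-id (bnd k)    = refl
substσT-id (eats a b) = cong₂ eats (substσT-id a) (substσT-id b)

substσF-id : ∀ φ → substσF var φ ≡ φ
substσF-id (mem a b)  = cong₂ mem (substσT-id a) (substσT-id b)
substσF-id (eq a b)   = cong₂ eq (substσT-id a) (substσT-id b)
substσF-id (disj A B) = cong₂ disj (substσF-id A) (substσF-id B)
substσF-id (neg A)    = cong neg (substσF-id A)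
substσF-id (ex A)     = cong ex (substσF-id A)

openT-lc : ∀ d t u → lcT 0 u → openT d t u ≡ u
openT-lc d t zer        _       = refl
openT-lc d t (var j)    _       = refl
openT-lc d t (eats a b) (p , q) = cong₂ eats (openT-lc d t a p) (openT-lc d t b q)

openT-substσT-closeT : ∀ σ d x t u → LCSubst σ → lcT d u →
                       openT d t (substσT σ (closeT d x u)) ≡ substσT (σ [ x ↦ t ]) u
openT-substσT-closeT σ d x t zer        _  _ = refl
openT-substσT-closeT σ d x t (var j)    lσ _ with x ≡ᵇ j
... | true rewrite ≡ᵇ-refl d = refl
... | false = openT-lc d t (σ j) (lσ j)
openT-substσT-closeT σ d x t (bnd k)    _  k<d rewrite <⇒≡ᵇ-false k<d = refl
openT-substσT-closeT σ d x t (eats a b) lσ (p , q) =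
  cong₂ eats (openT-substσT-closeT σ d x t a lσ p) (openT-substσT-closeT σ d x t b lσ q)

openF-substσF-closeF : ∀ σ d x t φ → LCSubst σ → lcF d φ →
                       openF d t (substσF σ (closeF d x φ)) ≡ substσF (σ [ x ↦ t ]) φ
openF-substσF-closeF σ d x t (mem a b) l (p , q) =
  cong₂ mem (openT-substσT-closeT σ d x t a l p) (openT-substσT-closeT σ d x t b l q)
openF-substσF-closeF σ d x t (eq a b) l (p , q) =
  cong₂ eq (openT-substσT-closeT σ d x t a l p) (openT-substσT-closeT σ d x t b l q)
openF-substσF-closeF σ d x t (disj A B) l (p , q) =
  cong₂ disj (openF-substσF-closeF σ d x t A l p) (openF-substσF-closeF σ d x t B l q)
openF-substσF-closeF σ d x t (neg A) l p = cong neg (openF-substσF-closeF σ d x t A l p)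
openF-substσF-closeF σ d x t (ex A)  l p = cong ex (openF-substσF-closeF σ (suc d) x t A l p)

nor-intro : ∀ {b c : Bool} → b ≡ false → c ≡ false → (if b then true else c) ≡ false
nor-intro refl refl = refl

nor-elimˡ : ∀ (b : Bool) {c} → (if b then true else c) ≡ false → b ≡ false
nor-elimˡ false _ = refl

nor-elimʳ : ∀ (b : Bool) {c} → (if b then true else c) ≡ false → c ≡ false
nor-elimʳ false e = e

occT-closeT : ∀ d x u → occT x (closeT d x u) ≡ false
occT-closeT d x zer        = refl
occT-closeT d x (var j) with x ≡ᵇ j in e
... | true  = refl
... | false = e
occT-closeT d x (bnd k)    = refl
occT-closeT d x (eats a b) = nor-intro (occT-closeT d x a) (occT-closeT d x b)

occF-closeF : ∀ d x φ → occF x (closeF d x φ) ≡ false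
occF-closeF d x (mem a b)  = nor-intro (occT-closeT d x a) (occT-closeT d x b)
occF-closeF d x (eq a b)   = nor-intro (occT-closeT d x a) (occT-closeT d x b)
occF-closeF d x (disj A B) = nor-intro (occF-closeF d x A) (occF-closeF d x B)
occF-closeF d x (neg A)    = occF-closeF d x A
occF-closeF d x (ex A)     = occF-closeF (suc d) x A

varBoundT : Tm → ℕ
varBoundT zer        = 0
varBoundT (var j)    = suc j
varBoundT (bnd k)    = 0
varBoundT (eats a b) = varBoundT a ⊔ varBoundT b

varBoundF : Fm → ℕ
varBoundF (mem a b)  = varBoundT a ⊔ varBoundT b
varBoundF (eq a b)   = varBoundT a ⊔ varBoundT b
varBoundF (disj A B) = varBoundF A ⊔ varBoundF B
varBoundF (neg A)    = varBoundF A
varBoundF (ex A)     = varBoundF A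

varBoundT-fresh : ∀ p u → varBoundT u ≤ p → occT p u ≡ false
varBoundT-fresh p zer        _ = refl
varBoundT-fresh p (var j)    h = <⇒≡ᵇ-false h
varBoundT-fresh p (bnd k)    _ = refl
varBoundT-fresh p (eats a b) h =
  nor-intro (varBoundT-fresh p a (m⊔n≤o⇒m≤o (varBoundT a) _ h))
            (varBoundT-fresh p b (m⊔n≤o⇒n≤o (varBoundT a) _ h))

varBoundF-fresh : ∀ p φ → varBoundF φ ≤ p → Fresh p φ
varBoundF-fresh p (mem a b) h =
  nor-intro (varBoundT-fresh p a (m⊔n≤o⇒m≤o (varBoundT a) _ h))
            (varBoundT-fresh p b (m⊔n≤o⇒n≤o (varBoundT a) _ h))
varBoundF-fresh p (eq a b) h =
  nor-intro (varBoundT-fresh p a (m⊔n≤o⇒m≤o (varBoundT a) _ h))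
            (varBoundT-fresh p b (m⊔n≤o⇒n≤o (varBoundT a) _ h))
varBoundF-fresh p (disj A B) h =
  nor-intro (varBoundF-fresh p A (m⊔n≤o⇒m≤o (varBoundF A) _ h))
            (varBoundF-fresh p B (m⊔n≤o⇒n≤o (varBoundF A) _ h))
varBoundF-fresh p (neg A) h = varBoundF-fresh p A h
varBoundF-fresh p (ex A)  h = varBoundF-fresh p A h

lcT? : ∀ d t → Dec (lcT d t)
lcT? d zer        = yes tt
lcT? d (var i)    = yes tt
lcT? d (bnd k)    = k <? d
lcT? d (eats t u) = lcT? d t ×-dec lcT? d u

lcF? : ∀ d φ → Dec (lcF d φ)
lcF? d (mem a b)  = lcT? d a ×-dec lcT? d b
lcF? d (eq a b)   = lcT? d a ×-dec lcT? d b
lcF? d (disj A B) = lcF? d A ×-dec lcF? d B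
lcF? d (neg A)    = lcF? d A
lcF? d (ex A)     = lcF? (suc d) A

lc! : (φ : Fm) → {w : True (lcF? 0 φ)} → LC φ
lc! φ {w} = toWitness w

lcT-from0 : ∀ d u → lcT 0 u → lcT d u
lcT-from0 d zer        _       = tt
lcT-from0 d (var j)    _       = tt
lcT-from0 d (eats a b) (p , q) = lcT-from0 d a p , lcT-from0 d b q

lcT-substσT : ∀ {σ} d u → LCSubst σ → lcT d u → lcT d (substσT σ u)
lcT-substσT d zer        l _       = tt
lcT-substσT {σ} d (var j) l _      = lcT-from0 d (σ j) (l j)
lcT-substσT d (bnd k)    l p       = p
lcT-substσT d (eats a b) l (p , q) = lcT-substσT d a l p , lcT-substσT d b l q

lcF-substσF : ∀ {σ} d φ → LCSubst σ → lcF d φ → lcF d (substσF σ φ)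
lcF-substσF d (mem a b)  l (p , q) = lcT-substσT d a l p , lcT-substσT d b l q
lcF-substσF d (eq a b)   l (p , q) = lcT-substσT d a l p , lcT-substσT d b l q
lcF-substσF d (disj A B) l (p , q) = lcF-substσF d A l p , lcF-substσF d B l q
lcF-substσF d (neg A)    l p       = lcF-substσF d A l p
lcF-substσF d (ex A)     l p       = lcF-substσF (suc d) A l p

lcS : ∀ σ φ → LCSubst σ → {w : True (lcF? 0 φ)} → LC (substσF σ φ)
lcS σ φ lσ {w} = lcF-substσF 0 φ lσ (toWitness w)

lcT-openT⁻ : ∀ d t u → lcT d (openT d t u) → lcT (suc d) u
lcT-openT⁻ d t zer _ = tt
lcT-openT⁻ d t (var j) _ = tt
lcT-openT⁻ d t (bnd k) p with d ≡ᵇ k in e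
... | true rewrite ≡ᵇ-true⇒≡ d k e = ≤-refl
... | false = m≤n⇒m≤1+n p
lcT-openT⁻ d t (eats a b) (p , q) = lcT-openT⁻ d t a p , lcT-openT⁻ d t b q

lcF-openF⁻ : ∀ d t φ → lcF d (openF d t φ) → lcF (suc d) φ
lcF-openF⁻ d t (mem a b)  (p , q) = lcT-openT⁻ d t a p , lcT-openT⁻ d t b q
lcF-openF⁻ d t (eq a b)   (p , q) = lcT-openT⁻ d t a p , lcT-openT⁻ d t b q
lcF-openF⁻ d t (disj A B) (p , q) = lcF-openF⁻ d t A p , lcF-openF⁻ d t B q
lcF-openF⁻ d t (neg A)    p       = lcF-openF⁻ d t A p
lcF-openF⁻ d t (ex A)     p       = lcF-openF⁻ (suc d) t A p

lcT-closeT : ∀ d x u → lcT d u → lcT (suc d) (closeT d x u)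
lcT-closeT d x zer        _ = tt
lcT-closeT d x (var j)    _ with x ≡ᵇ j
... | true  = ≤-refl
... | false = tt
lcT-closeT d x (bnd k)    p = m≤n⇒m≤1+n p
lcT-closeT d x (eats a b) (p , q) = lcT-closeT d x a p , lcT-closeT d x b q

lcF-closeF : ∀ d x φ → lcF d φ → lcF (suc d) (closeF d x φ)
lcF-closeF d x (mem a b)  (p , q) = lcT-closeT d x a p , lcT-closeT d x b q
lcF-closeF d x (eq a b)   (p , q) = lcT-closeT d x a p , lcT-closeT d x b q
lcF-closeF d x (disj A B) (p , q) = lcF-closeF d x A p , lcF-closeF d x B q
lcF-closeF d x (neg A)    p       = lcF-closeF d x A p
lcF-closeF d x (ex A)     p       = lcF-closeF (suc d) x A p

LC-exN : ∀ x φ → LC φ → LC (exN x φ)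
LC-exN x φ = lcF-closeF 0 x φ

LC-allN : ∀ x φ → LC φ → LC (allN x φ)
LC-allN x φ = lcF-closeF 0 x (neg φ)

-- Ground terms, subterms and subformulas

Ground : Tm → Set
Ground zer        = ⊤
Ground (var _)    = ⊥
Ground (bnd _)    = ⊥
Ground (eats a b) = Ground a × Ground b

Ground⇒lc : ∀ t → Ground t → lcT 0 t
Ground⇒lc zer        _       = tt
Ground⇒lc (eats a b) (p , q) = Ground⇒lc a p , Ground⇒lc b q

Ground-ordT : ∀ n → Ground (ordT n)
Ground-ordT zero    = tt
Ground-ordT (suc n) = Ground-ordT n , Ground-ordT n

Ground-hpair : ∀ {a b} → Ground a → Ground b → Ground (hpair a b)
Ground-hpair pa pb = (tt , (tt , pa)) , ((tt , pa) , pb)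

Ground-htuple : ∀ n → Ground (htuple n)
Ground-htuple zero    = Ground-hpair tt tt
Ground-htuple (suc n) = Ground-hpair tt (Ground-htuple n)

Ground-⌜⌝T : ∀ t → Ground ⌜ t ⌝T
Ground-⌜⌝T zer        = tt
Ground-⌜⌝T (var i)    = Ground-ordT (suc i)
Ground-⌜⌝T (bnd k)    = Ground-hpair (Ground-htuple 6) (Ground-ordT k)
Ground-⌜⌝T (eats a b) = Ground-hpair (Ground-htuple 1) (Ground-hpair (Ground-⌜⌝T a) (Ground-⌜⌝T b))

Ground-⌜⌝F : ∀ A → Ground ⌜ A ⌝F
Ground-⌜⌝F (mem a b)  = Ground-hpair (Ground-htuple 0) (Ground-hpair (Ground-⌜⌝T a) (Ground-⌜⌝T b))
Ground-⌜⌝F (eq a b)   = Ground-hpair (Ground-htuple 2) (Ground-hpair (Ground-⌜⌝T a) (Ground-⌜⌝T b))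
Ground-⌜⌝F (disj A B) = Ground-hpair (Ground-htuple 3) (Ground-hpair (Ground-⌜⌝F A) (Ground-⌜⌝F B))
Ground-⌜⌝F (neg A)    = Ground-hpair (Ground-htuple 4) (Ground-⌜⌝F A)
Ground-⌜⌝F (ex A)     = Ground-hpair (Ground-htuple 5) (Ground-⌜⌝F A)

lc-hpair : ∀ {a b} → lcT 0 a → lcT 0 b → lcT 0 (hpair a b)
lc-hpair la lb = (tt , (tt , la)) , ((tt , la) , lb)

lc-ordT : ∀ n → lcT 0 (ordT n)
lc-ordT n = Ground⇒lc _ (Ground-ordT n)

lc-⌜⌝T : ∀ t → lcT 0 ⌜ t ⌝T
lc-⌜⌝T t = Ground⇒lc _ (Ground-⌜⌝T t)

lc-⌜⌝F : ∀ A → lcT 0 ⌜ A ⌝F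
lc-⌜⌝F A = Ground⇒lc _ (Ground-⌜⌝F A)

subterms : Tm → List Tm
subterms (eats a b) = eats a b ∷ subterms a ++ subterms b
subterms t          = t ∷ []

subterms-refl : ∀ t → t ∈ subterms t
subterms-refl zer        = here refl
subterms-refl (var _)    = here refl
subterms-refl (bnd _)    = here refl
subterms-refl (eats _ _) = here refl

subterms-trans : ∀ {s u} t → s ∈ subterms t → u ∈ subterms s → u ∈ subterms t
subterms-trans zer        (here refl) u∈ = u∈
subterms-trans (var _)    (here refl) u∈ = u∈
subterms-trans (bnd _)    (here refl) u∈ = u∈
subterms-trans (eats a b) (here refl) u∈ = u∈
subterms-trans (eats a b) (there s∈) u∈ with ∈-++⁻ (subterms a) s∈
... | inj₁ s∈a = there (∈-++⁺ˡ (subterms-trans a s∈a u∈))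
... | inj₂ s∈b = there (∈-++⁺ʳ (subterms a) (subterms-trans b s∈b u∈))

subterms-eatsˡ : ∀ a b → a ∈ subterms (eats a b)
subterms-eatsˡ a b = there (∈-++⁺ˡ (subterms-refl a))

subterms-eatsʳ : ∀ a b → b ∈ subterms (eats a b)
subterms-eatsʳ a b = there (∈-++⁺ʳ (subterms a) (subterms-refl b))

Ground-subterms : ∀ {s} t → Ground t → s ∈ subterms t → Ground s
Ground-subterms zer        g (here refl) = g
Ground-subterms (eats a b) g (here refl) = g
Ground-subterms (eats a b) (ga , gb) (there s∈) with ∈-++⁻ (subterms a) s∈
... | inj₁ s∈a = Ground-subterms a ga s∈a
... | inj₂ s∈b = Ground-subterms b gb s∈b

subformulas : Fm → List Fm
subformulas (disj A B) = disj A B ∷ subformulas A ++ subformulas B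
subformulas (neg A)    = neg A ∷ subformulas A
subformulas (ex A)     = ex A ∷ subformulas A
subformulas A          = A ∷ []

subformulas-refl : ∀ A → A ∈ subformulas A
subformulas-refl (mem _ _)  = here refl
subformulas-refl (eq _ _)   = here refl
subformulas-refl (disj _ _) = here refl
subformulas-refl (neg _)    = here refl
subformulas-refl (ex _)     = here refl

subformulas-trans : ∀ {B C} A → B ∈ subformulas A → C ∈ subformulas B → C ∈ subformulas A
subformulas-trans (mem _ _)  (here refl) C∈ = C∈
subformulas-trans (eq _ _)   (here refl) C∈ = C∈
subformulas-trans (disj _ _) (here refl) C∈ = C∈
subformulas-trans (neg _)    (here refl) C∈ = C∈
subformulas-trans (ex _)     (here refl) C∈ = C∈
subformulas-trans (disj A B) (there B∈) C∈ with ∈-++⁻ (subformulas A) B∈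
... | inj₁ B∈A = there (∈-++⁺ˡ (subformulas-trans A B∈A C∈))
... | inj₂ B∈B = there (∈-++⁺ʳ (subformulas A) (subformulas-trans B B∈B C∈))
subformulas-trans (neg A) (there B∈) C∈ = there (subformulas-trans A B∈ C∈)
subformulas-trans (ex A)  (there B∈) C∈ = there (subformulas-trans A B∈ C∈)

subformulas-disjˡ : ∀ A B → A ∈ subformulas (disj A B)
subformulas-disjˡ A B = there (∈-++⁺ˡ (subformulas-refl A))

subformulas-disjʳ : ∀ A B → B ∈ subformulas (disj A B)
subformulas-disjʳ A B = there (∈-++⁺ʳ (subformulas A) (subformulas-refl B))

subformulas-neg : ∀ A → A ∈ subformulas (neg A)
subformulas-neg A = there (subformulas-refl A)

subformulas-ex : ∀ A → A ∈ subformulas (ex A)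
subformulas-ex A = there (subformulas-refl A)

setOf : List Tm → Tm
setOf []       = zer
setOf (e ∷ es) = eats (setOf es) e

lc-setOf : ∀ {es} → All (lcT 0) es → lcT 0 (setOf es)
lc-setOf []         = tt
lc-setOf (le ∷ les) = lc-setOf les , le

pairsOf : {X : Set} → (X → Tm) → (X → Tm) → List X → List Tm
pairsOf g h = map (λ s → hpair (g s) (h s))

lc-pairsOf : ∀ {X : Set} (g h : X → Tm) xs → (∀ {s} → s ∈ xs → lcT 0 (g s) × lcT 0 (h s)) →
             All (lcT 0) (pairsOf g h xs)
lc-pairsOf g h []       closed = []
lc-pairsOf g h (s ∷ xs) closed =
  lc-hpair (proj₁ (closed (here refl))) (proj₂ (closed (here refl))) ∷ lc-pairsOf g h xs (λ s∈ → closed (there s∈))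

-- QuoteP, SubstTermP and SubstFormP are all of the form PairSetP k x y R, definitionally.
PairSetP : ℕ → Tm → Tm → Fm → Fm
PairSetP k x y R =
  exN k (mem (hpair x y) (v k) ∧F
    all∈ (k + 1) (v k) (exN (k + 2) (exN (k + 3) (eq (v (k + 1)) (hpair (v (k + 2)) (v (k + 3))) ∧F R))))

offset-≢ : ∀ k {m n} → m ≢ n → k + m ≢ k + n
offset-≢ k m≢n e = m≢n (+-cancelˡ-≡ k _ _ e)

mem-pairSet : ∀ σ k L p →
              substσF ((σ [ k ↦ L ]) [ k + 1 ↦ var p ]) (mem (v (k + 1)) (v k)) ≡ mem (var p) L
mem-pairSet σ k L p =
  cong₂ mem (upd-same (σ [ k ↦ L ]) (k + 1) (var p))
            (trans (upd-other (σ [ k ↦ L ]) (var p) (m+1+n≢m k)) (upd-same σ k L))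

pairSet-pair : ∀ σ k p a b →
               substσF (((σ [ k + 1 ↦ var p ]) [ k + 2 ↦ a ]) [ k + 3 ↦ b ])
                       (eq (v (k + 1)) (hpair (v (k + 2)) (v (k + 3))))
               ≡ eq (var p) (hpair a b)
pairSet-pair σ k p a b = cong₂ eq at-k+1 (cong₂ hpair at-k+2 (upd-same σ₂ (k + 3) b))
  where
    σ₁ = σ [ k + 1 ↦ var p ]
    σ₂ = σ₁ [ k + 2 ↦ a ]
    at-k+1 : (σ₂ [ k + 3 ↦ b ]) (k + 1) ≡ var p
    at-k+1 = trans (upd-other σ₂ b (offset-≢ k {3} {1} λ ()))
                   (trans (upd-other σ₁ a (offset-≢ k {2} {1} λ ())) (upd-same σ (k + 1) (var p)))
    at-k+2 : (σ₂ [ k + 3 ↦ b ]) (k + 2) ≡ a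
    at-k+2 = trans (upd-other σ₂ b (offset-≢ k {3} {2} λ ())) (upd-same σ₁ (k + 2) a)

-- Derivations

module Calculus (E : Fm) where

  infix 2 ⊢_
  ⊢_ : Fm → Set
  ⊢ A = Deriv E ∅ A

  ⊢-lc : ∀ {A} → ⊢ A → LC A
  ⊢-lc (hyp ())
  ⊢-lc (axm _ l) = l
  ⊢-lc (mp d e)  = proj₂ (⊢-lc d)
  ⊢-lc (exists {A} i d _ _ _) = lcF-openF⁻ 0 (var i) A (proj₁ (⊢-lc d)) , proj₂ (⊢-lc d)

  ⇒-refl : ∀ {A} → LC A → ⊢ A ⇒ A
  ⇒-refl l = axm (ident _) (l , l)

  ∨-intro₁⇒ : ∀ {A B} → LC A → LC B → ⊢ A ⇒ (A ∨F B)
  ∨-intro₁⇒ la lb = axm (disjI1 _ _) (la , la , lb)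

  ∨-intro₁ : ∀ {A B} → ⊢ A → LC B → ⊢ A ∨F B
  ∨-intro₁ d lb = mp (∨-intro₁⇒ (⊢-lc d) lb) d

  ∨-idem : ∀ {A} → ⊢ A ∨F A → ⊢ A
  ∨-idem d = mp (axm (disjCont _) (⊢-lc d , proj₁ (⊢-lc d))) d

  ∨-assoc : ∀ {A B C} → ⊢ A ∨F (B ∨F C) → ⊢ (A ∨F B) ∨F C
  ∨-assoc d = mp (axm (disjAssoc _ _ _) (l , (proj₁ l , proj₁ (proj₂ l)) , proj₂ (proj₂ l))) d
    where l = ⊢-lc d

  cut : ∀ {A B C} → ⊢ C ∨F A → ⊢ neg C ∨F B → ⊢ A ∨F B
  cut d e = mp (mp (axm (disjConj _ _ _) (⊢-lc d , ⊢-lc e , proj₂ (⊢-lc d) , proj₂ (⊢-lc e))) d) e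

  ∨-comm : ∀ {A B} → ⊢ A ∨F B → ⊢ B ∨F A
  ∨-comm d = cut d (⇒-refl (proj₁ (⊢-lc d)))

  ∨-intro₂ : ∀ {A B} → ⊢ B → LC A → ⊢ A ∨F B
  ∨-intro₂ d la = ∨-comm (∨-intro₁ d la)

  ∨-inj₁ : ∀ {A B} → (LC A → ⊢ A) → LC (A ∨F B) → ⊢ A ∨F B
  ∨-inj₁ d (la , lb) = ∨-intro₁ (d la) lb

  ∨-inj₂ : ∀ {A B} → (LC B → ⊢ B) → LC (A ∨F B) → ⊢ A ∨F B
  ∨-inj₂ d (la , lb) = ∨-intro₂ (d lb) la

  ∨-rotate : ∀ {X Y Z} → ⊢ X ∨F (Y ∨F Z) → ⊢ Z ∨F (X ∨F Y)
  ∨-rotate d = ∨-comm (∨-assoc d)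

  ∨-assoc⁻ : ∀ {A B C} → ⊢ (A ∨F B) ∨F C → ⊢ A ∨F (B ∨F C)
  ∨-assoc⁻ d = ∨-comm (∨-assoc (∨-comm (∨-assoc (∨-comm d))))

  ∨-monoʳ : ∀ {A B C} → ⊢ A ⇒ B → LC C → ⊢ (C ∨F A) ⇒ (C ∨F B)
  ∨-monoʳ d lc = ∨-assoc⁻ (cut (∨-comm (∨-assoc (⇒-refl (lc , proj₁ (⊢-lc d))))) d)

  ∨-monoˡ : ∀ {A A' D} → ⊢ A ⇒ A' → ⊢ A ∨F D → ⊢ A' ∨F D
  ∨-monoˡ d e = ∨-comm (mp (∨-monoʳ d (proj₂ (⊢-lc e))) (∨-comm e))

  ⇒-trans : ∀ {A B C} → ⊢ A ⇒ B → ⊢ B ⇒ C → ⊢ A ⇒ C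
  ⇒-trans d e = cut (∨-comm d) e

  ∨-intro₂⇒ : ∀ {A B} → LC A → LC B → ⊢ B ⇒ (A ∨F B)
  ∨-intro₂⇒ la lb = ∨-rotate (∨-rotate (∨-assoc⁻ (∨-intro₁ (∨-comm (⇒-refl lb)) la)))

  ∨-elim : ∀ {A B C} → ⊢ A ⇒ C → ⊢ B ⇒ C → ⊢ (A ∨F B) ⇒ C
  ∨-elim {A} {B} {C} d e =
    ∨-comm (∨-monoˡ (axm (disjCont C) ((lC , lC) , lC))
      (∨-assoc (∨-rotate (∨-assoc⁻ (cut (∨-rotate (∨-rotate (∨-assoc⁻
        (cut (∨-comm (∨-assoc (⇒-refl {A ∨F B} (lA , lB)))) e)))) d)))))
    where lA = proj₁ (⊢-lc d); lB = proj₁ (⊢-lc e); lC = proj₂ (⊢-lc d)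

  ¬¬-intro : ∀ {A} → LC A → ⊢ A ⇒ neg (neg A)
  ¬¬-intro l = ∨-comm (⇒-refl {neg _} l)

  ¬¬-elim : ∀ {A} → LC A → ⊢ neg (neg A) ⇒ A
  ¬¬-elim l = ∨-comm (mp (∨-monoʳ (¬¬-intro {neg _} l) l) (∨-comm (⇒-refl l)))

  contrapose : ∀ {A B} → ⊢ A ⇒ B → ⊢ neg B ⇒ neg A
  contrapose d = ∨-comm (mp (∨-monoʳ (¬¬-intro (proj₂ (⊢-lc d))) (proj₁ (⊢-lc d))) d)

  modus-tollens : ∀ {A B} → ⊢ A ⇒ B → ⊢ neg B → ⊢ neg A
  modus-tollens d e = mp (contrapose d) e

  ∧-elim₁⇒ : ∀ {A B} → LC A → LC B → ⊢ (A ∧F B) ⇒ A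
  ∧-elim₁⇒ la lb = ⇒-trans (contrapose (∨-intro₁⇒ {neg _} {neg _} la lb)) (¬¬-elim la)

  ∧-elim₂⇒ : ∀ {A B} → LC A → LC B → ⊢ (A ∧F B) ⇒ B
  ∧-elim₂⇒ la lb = ⇒-trans (contrapose (∨-intro₂⇒ {neg _} {neg _} la lb)) (¬¬-elim lb)

  ∧-intro⇒ : ∀ {C A B} → ⊢ C ⇒ A → ⊢ C ⇒ B → ⊢ C ⇒ (A ∧F B)
  ∧-intro⇒ d e = ⇒-trans (¬¬-intro (proj₁ (⊢-lc d))) (contrapose (∨-elim (contrapose d) (contrapose e)))

  ⇒-const : ∀ {C B} → ⊢ B → LC C → ⊢ C ⇒ B
  ⇒-const d lc = ∨-intro₂ d lc

  ∧-intro : ∀ {A B} → ⊢ A → ⊢ B → ⊢ A ∧F B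
  ∧-intro d e = mp (∧-intro⇒ (⇒-refl (⊢-lc d)) (⇒-const e (⊢-lc d))) d

  ⇒-absurd : ∀ {A B} → ⊢ neg A → LC B → ⊢ A ⇒ B
  ⇒-absurd d lb = ∨-intro₁ d lb

  ¬-self : ∀ {A} → ⊢ A ⇒ neg A → ⊢ neg A
  ¬-self d = ∨-idem d

  curry : ∀ {C A D} → ⊢ (C ∧F A) ⇒ D → ⊢ C ⇒ (A ⇒ D)
  curry d = ∨-assoc⁻ (∨-monoˡ (¬¬-elim (proj₁ (⊢-lc d))) d)

  uncurry : ∀ {C A D} → ⊢ C ⇒ (A ⇒ D) → ⊢ (C ∧F A) ⇒ D
  uncurry d = ∨-monoˡ (¬¬-intro (proj₁ l , proj₁ (proj₂ l))) (∨-assoc d)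
    where l = ⊢-lc d

  mp⇒ : ∀ {C A B} → ⊢ C ⇒ (A ⇒ B) → ⊢ C ⇒ A → ⊢ C ⇒ B
  mp⇒ d e = ⇒-trans (∧-intro⇒ (⇒-refl (proj₁ (⊢-lc d))) e) (uncurry d)

  ⇒-mapʳ : ∀ {C A B D} → ⊢ C ⇒ (A ⇒ B) → ⊢ B ⇒ D → ⊢ C ⇒ (A ⇒ D)
  ⇒-mapʳ d e = ⇒-trans d (∨-monoʳ e (proj₁ (proj₂ (⊢-lc d))))

  ⇔-elim₁ : ∀ {A B} → ⊢ A ⇔ B → ⊢ A ⇒ B
  ⇔-elim₁ d = mp (∧-elim₁⇒ (proj₁ (⊢-lc d)) (proj₂ (⊢-lc d))) d

  ⇔-elim₂ : ∀ {A B} → ⊢ A ⇔ B → ⊢ B ⇒ A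
  ⇔-elim₂ d = mp (∧-elim₂⇒ (proj₁ (⊢-lc d)) (proj₂ (⊢-lc d))) d

  ⊤F : Fm
  ⊤F = eq zer zer ⇒ eq zer zer

  ⊢⊤F : ⊢ ⊤F
  ⊢⊤F = ⇒-refl (tt , tt)

  ∀-intro-fresh : ∀ {C} σ x φ p → LCSubst σ → LC φ →
                  Fresh p C → Fresh p (substσF σ (closeF 0 x (neg φ))) →
                  ⊢ C ⇒ substσF (σ [ x ↦ var p ]) φ → ⊢ C ⇒ substσF σ (allN x φ)
  ∀-intro-fresh {C} σ x φ p lσ lφ fresh-C fresh-φ d =
    ⇒-trans (¬¬-intro (proj₁ (⊢-lc d))) (contrapose (exists p d′ fresh-φ fresh-C (λ _ ())))
    where
      d′ : ⊢ inst (substσF σ (closeF 0 x (neg φ))) (var p) ⇒ neg C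
      d′ = subst (λ X → ⊢ X ⇒ neg C) (sym (openF-substσF-closeF σ 0 x (var p) (neg φ) lσ lφ))
                 (contrapose d)

  ∀-intro⇒ : ∀ {C} σ x φ → LCSubst σ → LC φ →
             (∀ p → ⊢ C ⇒ substσF (σ [ x ↦ var p ]) φ) → ⊢ C ⇒ substσF σ (allN x φ)
  ∀-intro⇒ {C} σ x φ lσ lφ d =
    ∀-intro-fresh σ x φ p lσ lφ (nor-elimˡ (occF p C) fresh) (nor-elimʳ (occF p C) fresh) (d p)
    where
      p = varBoundF (disj C (substσF σ (closeF 0 x (neg φ))))
      fresh = varBoundF-fresh p (disj C (substσF σ (closeF 0 x (neg φ)))) ≤-refl

  ∀-intro : ∀ σ x φ → LCSubst σ → LC φ →
            (∀ p → ⊢ substσF (σ [ x ↦ var p ]) φ) → ⊢ substσF σ (allN x φ)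
  ∀-intro σ x φ lσ lφ d = mp (∀-intro⇒ σ x φ lσ lφ (λ p → ⇒-const (d p) (⊢-lc ⊢⊤F))) ⊢⊤F

  -- The eigenvariable is x itself, which is fresh for the premise ⊤F and for ∃x ¬φ.
  gen : ∀ x φ → ⊢ φ → ⊢ allN x φ
  gen x φ d = subst ⊢_ (substσF-id (allN x φ))
    (mp (∀-intro-fresh var x φ x LCSubst-var (⊢-lc d) refl fresh
          (⇒-const (subst ⊢_ (sym (trans (substσF-cong (upd-var-self x) φ) (substσF-id φ))) d)
                   (⊢-lc ⊢⊤F)))
        ⊢⊤F)
    where
      fresh : Fresh x (substσF var (closeF 0 x (neg φ)))
      fresh = subst (λ X → occF x X ≡ false) (sym (substσF-id (closeF 0 x (neg φ)))) (occF-closeF 0 x (neg φ))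

  ∃-intro⇒ : ∀ σ x φ t → LCSubst σ → LC φ → lcT 0 t →
             ⊢ substσF (σ [ x ↦ t ]) φ ⇒ substσF σ (exN x φ)
  ∃-intro⇒ σ x φ t lσ lφ lt = subst (λ X → ⊢ X ⇒ ex ψ) open-ψ
      (axm (spec ψ t lt) (subst LC (sym open-ψ) lφt , lcF-openF⁻ 0 t ψ (subst LC (sym open-ψ) lφt)))
    where
      ψ = substσF σ (closeF 0 x φ)
      open-ψ : inst ψ t ≡ substσF (σ [ x ↦ t ]) φ
      open-ψ = openF-substσF-closeF σ 0 x t φ lσ lφ
      lφt : LC (substσF (σ [ x ↦ t ]) φ)
      lφt = lcF-substσF 0 φ (LCSubst-upd x lσ lt) lφ

  ∀-elim⇒ : ∀ σ x φ t → LCSubst σ → LC φ → lcT 0 t →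
            ⊢ substσF σ (allN x φ) ⇒ substσF (σ [ x ↦ t ]) φ
  ∀-elim⇒ σ x φ t lσ lφ lt =
    ⇒-trans (contrapose (∃-intro⇒ σ x (neg φ) t lσ lφ lt)) (¬¬-elim (lcF-substσF 0 φ (LCSubst-upd x lσ lt) lφ))

  ∀-elim : ∀ σ x φ t → LCSubst σ → LC φ → lcT 0 t →
           ⊢ substσF σ (allN x φ) → ⊢ substσF (σ [ x ↦ t ]) φ
  ∀-elim σ x φ t lσ lφ lt d = mp (∀-elim⇒ σ x φ t lσ lφ lt) d

  ∃-intro : ∀ σ x φ t → LCSubst σ → LC φ → lcT 0 t →
            ⊢ substσF (σ [ x ↦ t ]) φ → ⊢ substσF σ (exN x φ)
  ∃-intro σ x φ t lσ lφ lt d = mp (∃-intro⇒ σ x φ t lσ lφ lt) d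

  ∃-intro₂ : ∀ σ x₁ x₂ φ t₁ t₂ → LCSubst σ → LC φ → lcT 0 t₁ → lcT 0 t₂ →
             ⊢ substσF ((σ [ x₁ ↦ t₁ ]) [ x₂ ↦ t₂ ]) φ → ⊢ substσF σ (exN x₁ (exN x₂ φ))
  ∃-intro₂ σ x₁ x₂ φ t₁ t₂ lσ lφ l₁ l₂ d =
    ∃-intro σ x₁ (exN x₂ φ) t₁ lσ (LC-exN x₂ φ lφ) l₁
      (∃-intro (σ [ x₁ ↦ t₁ ]) x₂ φ t₂ (LCSubst-upd x₁ lσ l₁) lφ l₂ d)

  ∃-intro₄ : ∀ σ x₁ x₂ x₃ x₄ φ t₁ t₂ t₃ t₄ → LCSubst σ → LC φ →
             lcT 0 t₁ → lcT 0 t₂ → lcT 0 t₃ → lcT 0 t₄ →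
             ⊢ substσF ((((σ [ x₁ ↦ t₁ ]) [ x₂ ↦ t₂ ]) [ x₃ ↦ t₃ ]) [ x₄ ↦ t₄ ]) φ →
             ⊢ substσF σ (exN x₁ (exN x₂ (exN x₃ (exN x₄ φ))))
  ∃-intro₄ σ x₁ x₂ x₃ x₄ φ t₁ t₂ t₃ t₄ lσ lφ l₁ l₂ l₃ l₄ d =
    ∃-intro₂ σ x₁ x₂ (exN x₃ (exN x₄ φ)) t₁ t₂ lσ (LC-exN x₃ (exN x₄ φ) (LC-exN x₄ φ lφ)) l₁ l₂
      (∃-intro₂ _ x₃ x₄ φ t₃ t₄ (LCSubst-upd x₂ (LCSubst-upd x₁ lσ l₁) l₂) lφ l₃ l₄ d)

  updates : (ℕ → Tm) → List (ℕ × Tm) → ℕ → Tm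
  updates σ []              = σ
  updates σ ((x , t) ∷ xts) = updates (σ [ x ↦ t ]) xts

  allNs : List (ℕ × Tm) → Fm → Fm
  allNs []              φ = φ
  allNs ((x , _) ∷ xts) φ = allN x (allNs xts φ)

  ClosedTerms : List (ℕ × Tm) → Set
  ClosedTerms = All (λ xt → lcT 0 (proj₂ xt))

  ∀-elims : ∀ σ xts φ → LCSubst σ → ClosedTerms xts → LC φ →
            ⊢ substσF σ (allNs xts φ) → ⊢ substσF (updates σ xts) φ
  ∀-elims σ []              φ lσ []         lφ d = d
  ∀-elims σ ((x , t) ∷ xts) φ lσ (lt ∷ lts) lφ d =
    ∀-elims (σ [ x ↦ t ]) xts φ (LCSubst-upd x lσ lt) lts lφ
      (∀-elim σ x (allNs xts φ) t lσ (LC-allNs xts) lt d)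
    where
      LC-allNs : ∀ yts → LC (allNs yts φ)
      LC-allNs []              = lφ
      LC-allNs ((y , _) ∷ yts) = LC-allN y (allNs yts φ) (LC-allNs yts)

  gens : ∀ xts φ → ⊢ φ → ⊢ allNs xts φ
  gens []              φ d = d
  gens ((x , _) ∷ xts) φ d = gen x _ (gens xts φ d)

  instantiate : ∀ {φ} → ⊢ φ → ∀ xts → ClosedTerms xts → ⊢ substσF (updates var xts) φ
  instantiate {φ} d xts lts =
    ∀-elims var xts φ LCSubst-var lts (⊢-lc d) (subst ⊢_ (sym (substσF-id (allNs xts φ))) (gens xts φ d))

  -- Equality, membership and ordinals

  axm! : ∀ {A} → Axiom E A → {w : True (lcF? 0 A)} → ⊢ A
  axm! a {w} = axm a (toWitness w)

  eq-refl : ∀ t → lcT 0 t → ⊢ eq t t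
  eq-refl t lt = instantiate (axm! reflAx) ((0 , t) ∷ []) (lt ∷ [])

  mem-cong : ∀ a b c d → lcT 0 a → lcT 0 b → lcT 0 c → lcT 0 d →
             ⊢ (eq a b ∧F eq c d) ⇒ (mem a c ⇒ mem b d)
  mem-cong a b c d pa pb pc pd =
    instantiate (axm! memCong) ((0 , a) ∷ (1 , b) ∷ (2 , c) ∷ (3 , d) ∷ []) (pa ∷ pb ∷ pc ∷ pd ∷ [])

  eq-cong : ∀ a b c d → lcT 0 a → lcT 0 b → lcT 0 c → lcT 0 d →
            ⊢ (eq a b ∧F eq c d) ⇒ (eq a c ⇒ eq b d)
  eq-cong a b c d pa pb pc pd =
    instantiate (axm! eqCong) ((0 , a) ∷ (1 , b) ∷ (2 , c) ∷ (3 , d) ∷ []) (pa ∷ pb ∷ pc ∷ pd ∷ [])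

  eq-sym : ∀ a b → lcT 0 a → lcT 0 b → ⊢ eq a b ⇒ eq b a
  eq-sym a b pa pb =
    mp⇒ (⇒-trans (∧-intro⇒ (⇒-refl (pa , pb)) (⇒-const (eq-refl a pa) (pa , pb))) (eq-cong a b a a pa pb pa pa))
        (⇒-const (eq-refl a pa) (pa , pb))

  mem-substʳ : ∀ x a a′ → lcT 0 x → lcT 0 a → lcT 0 a′ → ⊢ eq a a′ ⇒ (mem x a ⇒ mem x a′)
  mem-substʳ x a a′ px pa pa′ =
    ⇒-trans (∧-intro⇒ (⇒-const (eq-refl x px) (pa , pa′)) (⇒-refl (pa , pa′))) (mem-cong x x a a′ px px pa pa′)

  mem-substˡ : ∀ x x′ a → lcT 0 x → lcT 0 x′ → lcT 0 a → ⊢ eq x x′ ⇒ (mem x a ⇒ mem x′ a)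
  mem-substˡ x x′ a px px′ pa =
    ⇒-trans (∧-intro⇒ (⇒-refl (px , px′)) (⇒-const (eq-refl a pa) (px , px′))) (mem-cong x x′ a a px px′ pa pa)

  mem-by-eq : ∀ x e T → lcT 0 x → lcT 0 e → lcT 0 T → ⊢ mem e T → ⊢ eq x e ⇒ mem x T
  mem-by-eq x e T px pe pT d = mp⇒ (⇒-trans (eq-sym x e px pe) (mem-substˡ e x T pe px pT)) (⇒-const d (px , pe))

  ∉-zer : ∀ x → lcT 0 x → ⊢ neg (mem x zer)
  ∉-zer x lx = ∀-elim (var [ 0 ↦ zer ]) 1 (neg (mem (v 1) (v 0))) x (LCSubst-upd 0 LCSubst-var tt) (tt , tt) lx
                 (mp (⇔-elim₁ hf1-zer) (eq-refl zer tt))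
    where hf1-zer = instantiate (axm! hf1) ((0 , zer) ∷ []) (tt ∷ [])

  mem-eats⇔ : ∀ x L e → lcT 0 x → lcT 0 L → lcT 0 e → ⊢ mem x (eats L e) ⇔ (mem x L ∨F eq x e)
  mem-eats⇔ x L e px pL pe =
    ∀-elim σ 3 ψ x lσ (lc! ψ) px
      (mp (⇔-elim₁ hf2-Le) (eq-refl (eats L e) (pL , pe)))
    where
      ψ = mem (v 3) (v 0) ⇔ (mem (v 3) (v 1) ∨F eq (v 3) (v 2))
      σ = ((var [ 0 ↦ eats L e ]) [ 1 ↦ L ]) [ 2 ↦ e ]
      lσ = LCSubst-upd 2 (LCSubst-upd 1 (LCSubst-upd 0 LCSubst-var (pL , pe)) pL) pe
      hf2-Le = instantiate (axm! hf2) ((0 , eats L e) ∷ (1 , L) ∷ (2 , e) ∷ []) ((pL , pe) ∷ pL ∷ pe ∷ [])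

  mem-eats-cases : ∀ {D} x L e → lcT 0 x → lcT 0 L → lcT 0 e →
                   ⊢ mem x L ⇒ D → ⊢ eq x e ⇒ D → ⊢ mem x (eats L e) ⇒ D
  mem-eats-cases x L e px pL pe d₁ d₂ = ⇒-trans (⇔-elim₁ (mem-eats⇔ x L e px pL pe)) (∨-elim d₁ d₂)

  mem-eats-new : ∀ L e → lcT 0 L → lcT 0 e → ⊢ mem e (eats L e)
  mem-eats-new L e pL pe =
    mp (⇔-elim₂ (mem-eats⇔ e L e pe pL pe)) (mp (∨-intro₂⇒ (pe , pL) (pe , pe)) (eq-refl e pe))

  mem-eats-old : ∀ x L e → lcT 0 x → lcT 0 L → lcT 0 e → ⊢ mem x L → ⊢ mem x (eats L e)
  mem-eats-old x L e px pL pe d =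
    mp (⇒-trans (∨-intro₁⇒ (px , pL) (px , pe)) (⇔-elim₂ (mem-eats⇔ x L e px pL pe))) d

  eats≢zer : ∀ a b → lcT 0 a → lcT 0 b → ⊢ neg (eq (eats a b) zer)
  eats≢zer a b pa pb =
    modus-tollens
      (⇒-trans (⇔-elim₁ hf1-ab)
               (∀-elim⇒ (var [ 0 ↦ eats a b ]) 1 (neg (mem (v 1) (v 0))) b
                        (LCSubst-upd 0 LCSubst-var (pa , pb)) (tt , tt) pb))
      (mp (¬¬-intro (pb , pa , pb)) (mem-eats-new a b pa pb))
    where hf1-ab = instantiate (axm! hf1) ((0 , eats a b) ∷ []) ((pa , pb) ∷ [])

  mem-setOf : ∀ {e es} → e ∈ es → All (lcT 0) es → ⊢ mem e (setOf es)
  mem-setOf (here refl) (le ∷ les) = mem-eats-new _ _ (lc-setOf les) le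
  mem-setOf (there e∈)  (le ∷ les) =
    mem-eats-old _ _ _ (lookup les e∈) (lc-setOf les) le (mem-setOf e∈ les)

  mem-setOf-cases : ∀ {D} es x → lcT 0 x → All (lcT 0) es → LC D →
                    (∀ {e} → e ∈ es → ⊢ eq x e ⇒ D) → ⊢ mem x (setOf es) ⇒ D
  mem-setOf-cases []       x lx []         lD h = ⇒-absurd (∉-zer x lx) lD
  mem-setOf-cases (e ∷ es) x lx (le ∷ les) lD h =
    mem-eats-cases x (setOf es) e lx (lc-setOf les) le
      (mem-setOf-cases es x lx les lD (λ e∈ → h (there e∈))) (h (here refl))

  mem-ordT-cases : ∀ {D} n x → lcT 0 x → LC D →
                   (∀ j → j < n → ⊢ eq x (ordT j) ⇒ D) → ⊢ mem x (ordT n) ⇒ D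
  mem-ordT-cases zero    x lx lD h = ⇒-absurd (∉-zer x lx) lD
  mem-ordT-cases (suc n) x lx lD h =
    mem-eats-cases x (ordT n) (ordT n) lx (lc-ordT n) (lc-ordT n)
      (mem-ordT-cases n x lx lD (λ j j<n → h j (m≤n⇒m≤1+n j<n))) (h n ≤-refl)

  ordT-mem : ∀ m n → m < n → ⊢ mem (ordT m) (ordT n)
  ordT-mem m (suc n) (s≤s m≤n) with m≤n⇒m<n∨m≡n m≤n
  ... | inj₁ m<n  = mem-eats-old (ordT m) (ordT n) (ordT n) (lc-ordT m) (lc-ordT n) (lc-ordT n) (ordT-mem m n m<n)
  ... | inj₂ refl = mem-eats-new (ordT m) (ordT m) (lc-ordT m) (lc-ordT m)

  ordT-mono : ∀ j m r → lcT 0 r → j < m → ⊢ mem r (ordT j) ⇒ mem r (ordT m)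
  ordT-mono j m r lr j<m = mem-ordT-cases j r lr (lr , lc-ordT m)
    (λ l l<j → mem-by-eq r (ordT l) (ordT m) lr (lc-ordT l) (lc-ordT m) (ordT-mem l m (<-trans l<j j<m)))

  ordT-transitive : ∀ m q r → lcT 0 q → lcT 0 r → ⊢ mem q (ordT m) ⇒ (mem r q ⇒ mem r (ordT m))
  ordT-transitive m q r lq lr = mem-ordT-cases m q lq ((lr , lq) , (lr , lc-ordT m))
    (λ j j<m → ⇒-mapʳ (mem-substʳ r q (ordT j) lr lq (lc-ordT j)) (ordT-mono j m r lr j<m))

  eq-ordT-transitive : ∀ j p q r → lcT 0 p → lcT 0 q → lcT 0 r →
                       ⊢ eq p (ordT j) ⇒ (mem q p ⇒ (mem r q ⇒ mem r p))
  eq-ordT-transitive j p q r lp lq lr = curry (curry (mp⇒ (⇒-trans p≈oj oj⊆p) r∈oj))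
    where
      oj = ordT j
      lj = lc-ordT j
      C₁ = eq p oj ∧F mem q p
      lC₁ : LC C₁
      lC₁ = (lp , lj) , (lq , lp)
      p≈oj = ⇒-trans (∧-elim₁⇒ lC₁ (lr , lq)) (∧-elim₁⇒ (lp , lj) (lq , lp))
      q∈p  = ⇒-trans (∧-elim₁⇒ lC₁ (lr , lq)) (∧-elim₂⇒ (lp , lj) (lq , lp))
      r∈q  = ∧-elim₂⇒ lC₁ (lr , lq)
      q∈oj = mp⇒ (⇒-trans p≈oj (mem-substʳ q p oj lq lp lj)) q∈p
      r∈oj = mp⇒ (⇒-trans q∈oj (ordT-transitive j q r lq lr)) r∈q
      oj⊆p = ⇒-trans (eq-sym p oj lp lj) (mem-substʳ r oj p lr lj lp)

  ordT-elem-transitive : ∀ m p q r → lcT 0 p → lcT 0 q → lcT 0 r →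
                         ⊢ mem p (ordT m) ⇒ (mem q p ⇒ (mem r q ⇒ mem r p))
  ordT-elem-transitive m p q r lp lq lr = mem-ordT-cases m p lp ((lq , lp) , (lr , lq) , (lr , lp))
    (λ j _ → eq-ordT-transitive j p q r lp lq lr)

  -- The substituted formula is closed, so it is also the instance OrdP 21 (v 20) used for codes of bound variables.
  ordT-OrdP : ∀ n → ⊢ substσF (var [ 14 ↦ ordT n ]) (OrdP 20 (v 14))
  ordT-OrdP n = ∧-intro elems-⊆ elems-transitive
    where
      σ = var [ 14 ↦ ordT n ]
      lσ = LCSubst-upd 14 LCSubst-var (lc-ordT n)
      subset     = mem (v 21) (v 20) ⇒ mem (v 21) (v 14)
      transitive = mem (v 22) (v 21) ⇒ mem (v 22) (v 20)
      elems-⊆ : ⊢ substσF σ (all∈ 20 (v 14) (all∈ 21 (v 20) (mem (v 21) (v 14))))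
      elems-⊆ = ∀-intro σ 20 (mem (v 20) (v 14) ⇒ allN 21 subset) lσ (lc! (mem (v 20) (v 14) ⇒ allN 21 subset))
        λ p → ∀-intro⇒ (σ [ 20 ↦ var p ]) 21 subset (LCSubst-upd 20 lσ tt) (lc! subset)
        λ q → ordT-transitive n (var p) (var q) tt tt
      elems-transitive : ⊢ substσF σ (all∈ 20 (v 14) (all∈ 21 (v 20) (all∈ 22 (v 21) (mem (v 22) (v 20)))))
      elems-transitive = ∀-intro σ 20 (mem (v 20) (v 14) ⇒ all∈ 21 (v 20) (allN 22 transitive)) lσ
                           (lc! (mem (v 20) (v 14) ⇒ all∈ 21 (v 20) (allN 22 transitive)))
        λ p → ∀-intro⇒ (σ [ 20 ↦ var p ]) 21 (mem (v 21) (v 20) ⇒ allN 22 transitive) (LCSubst-upd 20 lσ tt)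
                (lc! (mem (v 21) (v 20) ⇒ allN 22 transitive))
        λ q → curry (∀-intro⇒ ((σ [ 20 ↦ var p ]) [ 21 ↦ var q ]) 22 transitive
                               (LCSubst-upd 21 (LCSubst-upd 20 lσ tt) tt) (lc! transitive)
        λ r → uncurry (ordT-elem-transitive n (var p) (var q) (var r) tt tt tt))

  ordT-irrefl : ∀ m → ⊢ neg (mem (ordT m) (ordT m))
  ordT-irrefl zero    = ∉-zer zer tt
  ordT-irrefl (suc n) =
    modus-tollens (⇔-elim₁ (mem-eats⇔ o′ o o lo′ lo lo)) (¬-self (∨-elim (⇒-absurd ¬o′∈o lAB) (⇒-absurd o′≉o lAB)))
    where
      o = ordT n ; o′ = ordT (suc n)
      lo = lc-ordT n ; lo′ = lc-ordT (suc n)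
      lAB : LC (neg (mem o′ o ∨F eq o′ o))
      lAB = (lo′ , lo) , (lo′ , lo)
      o∈o′ = mem-eats-new o o lo lo
      ¬o′∈o : ⊢ neg (mem o′ o)
      ¬o′∈o = modus-tollens (mp⇒ (ordT-transitive n o′ o lo′ lo) (⇒-const o∈o′ (lo′ , lo))) (ordT-irrefl n)
      o′≉o : ⊢ neg (eq o′ o)
      o′≉o = modus-tollens (mp⇒ (mem-substʳ o o′ o lo lo′ lo) (⇒-const o∈o′ (lo′ , lo))) (ordT-irrefl n)

  ordT-distinct< : ∀ m n → m < n → ⊢ neg (eq (ordT m) (ordT n))
  ordT-distinct< m n m<n =
    modus-tollens (mp⇒ (⇒-trans (eq-sym (ordT m) (ordT n) (lc-ordT m) (lc-ordT n))
                                (mem-substʳ (ordT m) (ordT n) (ordT m) (lc-ordT m) (lc-ordT n) (lc-ordT m)))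
                       (⇒-const (ordT-mem m n m<n) (lc-ordT m , lc-ordT n)))
                  (ordT-irrefl m)

  ordT-distinct : ∀ m n → m ≢ n → ⊢ neg (eq (ordT m) (ordT n))
  ordT-distinct m n m≢n with <-cmp m n
  ... | tri< m<n _ _ = ordT-distinct< m n m<n
  ... | tri≈ _ m≡n _ = ⊥-elim (m≢n m≡n)
  ... | tri> _ _ n<m = modus-tollens (eq-sym (ordT m) (ordT n) (lc-ordT m) (lc-ordT n)) (ordT-distinct< n m n<m)

  -- Witnesses for the Σ formulas

  pairSet-intro : ∀ {X : Set} σ k x y R (g h : X → Tm) (xs : List X) →
                  let σL = σ [ k ↦ setOf (pairsOf g h xs) ] in
                  LCSubst σ → lcT 0 x → lcT 0 y → LC R →
                  hpair (substσT σL x) (substσT σL y) ∈ pairsOf g h xs →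
                  (∀ {s} → s ∈ xs → lcT 0 (g s) × lcT 0 (h s)) →
                  (∀ {s} → s ∈ xs → ∀ p →
                     ⊢ substσF (((σL [ k + 1 ↦ var p ]) [ k + 2 ↦ g s ]) [ k + 3 ↦ h s ]) R) →
                  ⊢ substσF σ (PairSetP k x y R)
  pairSet-intro σ k x y R g h xs lσ lx ly lR xy∈ closed step =
    ∃-intro σ k (mem (hpair x y) (v k) ∧F all∈ (k + 1) (v k) B) L lσ
            ((lc-hpair lx ly , tt) , LC-allN (k + 1) elem ((tt , tt) , lB)) (lc-setOf les)
      (∧-intro (subst (λ S → ⊢ mem (substσT σL (hpair x y)) S) (sym (upd-same σ k L)) (mem-setOf xy∈ les))
               (∀-intro σL (k + 1) elem lσL ((tt , tt) , lB) elem-step))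
    where
      es   = pairsOf g h xs
      L    = setOf es
      σL   = σ [ k ↦ L ]
      Pair = eq (v (k + 1)) (hpair (v (k + 2)) (v (k + 3))) ∧F R
      B    = exN (k + 2) (exN (k + 3) Pair)
      elem = mem (v (k + 1)) (v k) ⇒ B
      lPair : LC Pair
      lPair = (tt , lc-hpair {var (k + 2)} {var (k + 3)} tt tt) , lR
      lB  = LC-exN (k + 2) (exN (k + 3) Pair) (LC-exN (k + 3) Pair lPair)
      les = lc-pairsOf g h xs closed
      lσL = LCSubst-upd k lσ (lc-setOf les)
      elem-step : ∀ p → ⊢ substσF (σL [ k + 1 ↦ var p ]) elem
      elem-step p = subst (λ F → ⊢ neg F ∨F substσF σP B) (sym (mem-pairSet σ k L p))
                      (mem-setOf-cases es (var p) tt les (lcF-substσF 0 B lσP lB) by-pair)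
        where
          σP  = σL [ k + 1 ↦ var p ]
          lσP = LCSubst-upd (k + 1) lσL tt
          by-pair : ∀ {e} → e ∈ es → ⊢ eq (var p) e ⇒ substσF σP B
          by-pair e∈ with ∈-map⁻ (λ s → hpair (g s) (h s)) e∈
          ... | s , s∈ , refl =
            ⇒-trans (∧-intro⇒ (subst (λ F → ⊢ eq (var p) (hpair (g s) (h s)) ⇒ F)
                                      (sym (pairSet-pair σL k p (g s) (h s))) (⇒-refl (tt , lgh)))
                              (⇒-const (step s∈ p) (tt , lgh)))
              (⇒-trans (∃-intro⇒ (σP [ k + 2 ↦ g s ]) (k + 3) Pair (h s) (LCSubst-upd (k + 2) lσP lg) lPair lh)
                       (∃-intro⇒ σP (k + 2) (exN (k + 3) Pair) (g s) lσP (LC-exN (k + 3) Pair lPair) lg))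
            where
              lg  = proj₁ (closed s∈)
              lh  = proj₂ (closed s∈)
              lgh = lc-hpair lg lh

  -- quoteStep, termStep and formStep are the clauses R of QuoteP 4, SubstTermP 12 and SubstFormP 4,
  -- written with the variable numbers these instances use.

  quoteEats quoteStep : Fm
  quoteEats = mem (hpair (v 8) (v 9)) (v 4) ∧F mem (hpair (v 10) (v 11)) (v 4)
              ∧F eq (v 6) (eats (v 8) (v 10)) ∧F eq (v 7) (qEats (v 9) (v 11))
  quoteStep = (eq (v 6) zer ∧F eq (v 7) zer) ∨F exN 8 (exN 9 (exN 10 (exN 11 quoteEats)))

  QuoteP-intro : ∀ t → Ground t → ⊢ substσF ((var [ 1 ↦ t ]) [ 3 ↦ ⌜ t ⌝T ]) (QuoteP 4 (v 1) (v 3))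
  QuoteP-intro t gt =
    pairSet-intro σ 4 (v 1) (v 3) quoteStep id ⌜_⌝T (subterms t) lσ tt tt (lc! quoteStep)
      (∈-map⁺ pairOf (subterms-refl t)) closed (λ {s} s∈ → step s (Ground-subterms t gt s∈) s∈)
    where
      pairOf = λ s → hpair s ⌜ s ⌝T
      σ  = (var [ 1 ↦ t ]) [ 3 ↦ ⌜ t ⌝T ]
      lσ = LCSubst-upd 3 (LCSubst-upd 1 LCSubst-var (Ground⇒lc t gt)) (lc-⌜⌝T t)
      closed : ∀ {s} → s ∈ subterms t → lcT 0 s × lcT 0 ⌜ s ⌝T
      closed {s} s∈ = Ground⇒lc s (Ground-subterms t gt s∈) , lc-⌜⌝T s
      les = lc-pairsOf id ⌜_⌝T (subterms t) closed
      σs : ℕ → Tm → ℕ → Tm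
      σs p s = (((σ [ 4 ↦ setOf (pairsOf id ⌜_⌝T (subterms t)) ]) [ 5 ↦ var p ]) [ 6 ↦ s ]) [ 7 ↦ ⌜ s ⌝T ]
      lσs : ∀ p s → lcT 0 s → LCSubst (σs p s)
      lσs p s ls = LCSubst-upd 7 (LCSubst-upd 6 (LCSubst-upd 5 (LCSubst-upd 4 lσ (lc-setOf les)) tt) ls) (lc-⌜⌝T s)
      step : ∀ s → Ground s → s ∈ subterms t → ∀ p → ⊢ substσF (σs p s) quoteStep
      step zer _ _ p = ∨-inj₁ (const (∧-intro (eq-refl zer tt) (eq-refl zer tt))) (lcS (σs p zer) quoteStep (lσs p zer tt))
      step (eats a b) (ga , gb) s∈ p = ∨-inj₂ (const
          (∃-intro₄ (σs p (eats a b)) 8 9 10 11 quoteEats a ⌜ a ⌝T b ⌜ b ⌝T (lσs p (eats a b) (la , lb)) (lc! quoteEats)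
                    la (lc-⌜⌝T a) lb (lc-⌜⌝T b)
            (∧-intro (mem-setOf (∈-map⁺ pairOf (subterms-trans t s∈ (subterms-eatsˡ a b))) les)
            (∧-intro (mem-setOf (∈-map⁺ pairOf (subterms-trans t s∈ (subterms-eatsʳ a b))) les)
            (∧-intro (eq-refl (eats a b) (la , lb)) (eq-refl ⌜ eats a b ⌝T (lc-⌜⌝T (eats a b))))))))
        (lcS (σs p (eats a b)) quoteStep (lσs p (eats a b) (la , lb)))
        where
          la = Ground⇒lc a ga
          lb = Ground⇒lc b gb

  termEats termStep : Fm
  termEats = mem (hpair (v 16) (v 17)) (v 12) ∧F mem (hpair (v 18) (v 19)) (v 12)
             ∧F eq (v 14) (qEats (v 16) (v 18)) ∧F eq (v 15) (qEats (v 17) (v 19))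
  termStep = TermBaseP 20 (v 0) (v 3) (v 14) (v 15) ∨F exN 16 (exN 17 (exN 18 (exN 19 termEats)))

  SubstTermP-intro : ∀ i β t →
    ⊢ substσF ((((var [ 0 ↦ ⌜ var i ⌝T ]) [ 3 ↦ ⌜ β ⌝T ]) [ 8 ↦ ⌜ t ⌝T ]) [ 9 ↦ ⌜ t [ i ≔ β ]T ⌝T ])
              (SubstTermP 12 (v 0) (v 3) (v 8) (v 9))
  SubstTermP-intro i β t =
    pairSet-intro σ 12 (v 8) (v 9) termStep ⌜_⌝T image (subterms t) lσ tt tt (lc! termStep)
      (∈-map⁺ pairOf (subterms-refl t)) (λ {s} _ → lc-⌜⌝T s , lc-⌜⌝T (s [ i ≔ β ]T)) (λ {s} s∈ → step s s∈)
    where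
      image : Tm → Tm
      image s = ⌜ s [ i ≔ β ]T ⌝T
      pairOf = λ s → hpair ⌜ s ⌝T (image s)
      σ  = (((var [ 0 ↦ ⌜ var i ⌝T ]) [ 3 ↦ ⌜ β ⌝T ]) [ 8 ↦ ⌜ t ⌝T ]) [ 9 ↦ image t ]
      lσ = LCSubst-upd 9 (LCSubst-upd 8 (LCSubst-upd 3 (LCSubst-upd 0 LCSubst-var (lc-⌜⌝T (var i)))
                          (lc-⌜⌝T β)) (lc-⌜⌝T t)) (lc-⌜⌝T (t [ i ≔ β ]T))
      les = lc-pairsOf ⌜_⌝T image (subterms t) (λ {s} _ → lc-⌜⌝T s , lc-⌜⌝T (s [ i ≔ β ]T))
      σs : ℕ → Tm → Tm → ℕ → Tm
      σs p X Y = (((σ [ 12 ↦ setOf (pairsOf ⌜_⌝T image (subterms t)) ]) [ 13 ↦ var p ]) [ 14 ↦ X ]) [ 15 ↦ Y ]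
      lσs : ∀ p X Y → lcT 0 X → lcT 0 Y → LCSubst (σs p X Y)
      lσs p X Y lX lY = LCSubst-upd 15 (LCSubst-upd 14 (LCSubst-upd 13 (LCSubst-upd 12 lσ (lc-setOf les)) tt) lX) lY
      lstep : ∀ p X Y → lcT 0 X → lcT 0 Y → LC (substσF (σs p X Y) termStep)
      lstep p X Y lX lY = lcS (σs p X Y) termStep (lσs p X Y lX lY)
      step : ∀ s → s ∈ subterms t → ∀ p → ⊢ substσF (σs p ⌜ s ⌝T (image s)) termStep
      step zer _ p =
        ∨-inj₁ (∨-inj₁ (const (∧-intro (eq-refl zer tt) (eq-refl zer tt)))) (lstep p zer zer tt tt)
      -- single i β is definitionally var [ i ↦ β ].
      step (var j) _ p with i ≟ j
      ... | yes refl = subst (λ Y → ⊢ substσF (σs p w ⌜ Y ⌝T) termStep) (sym (upd-same var i β))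
          (∨-inj₁ (∨-inj₂ (∨-inj₁ (const (∧-intro (eq-refl w lw) (eq-refl ⌜ β ⌝T lβ))))) (lstep p w ⌜ β ⌝T lw lβ))
        where
          w  = ⌜ var i ⌝T
          lw = lc-⌜⌝T (var i)
          lβ = lc-⌜⌝T β
      ... | no i≢j = subst (λ Y → ⊢ substσF (σs p o ⌜ Y ⌝T) termStep) (sym (upd-other var β i≢j))
          (∨-inj₁ (∨-inj₂ (∨-inj₂ (∨-inj₁ (const
            (∧-intro (ordT-OrdP (suc j))
            (∧-intro (eats≢zer (ordT j) (ordT j) (lc-ordT j) (lc-ordT j))
            (∧-intro (ordT-distinct (suc j) (suc i) (λ e → i≢j (sym (suc-injective e))))
                     (eq-refl o lo)))))))) (lstep p o o lo lo))
        where
          o  = ⌜ var j ⌝T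
          lo = lc-⌜⌝T (var j)
      step (bnd k) _ p =
        ∨-inj₁ (∨-inj₂ (∨-inj₂ (∨-inj₂ (const
          (∃-intro (σs p X X) 20 bound (ordT k) (lσs p X X lX lX) (lc! bound) (lc-ordT k)
             (∧-intro (ordT-OrdP k) (∧-intro (eq-refl X lX) (eq-refl X lX)))))))) (lstep p X X lX lX)
        where
          X  = ⌜ bnd k ⌝T
          lX = lc-⌜⌝T (bnd k)
          bound = OrdP 21 (v 20) ∧F eq (v 14) (hpair (htuple 6) (v 20)) ∧F eq (v 15) (v 14)
      step (eats a b) s∈ p = ∨-inj₂ (const
          (∃-intro₄ (σs p X Y) 16 17 18 19 termEats ⌜ a ⌝T (image a) ⌜ b ⌝T (image b)
                    (lσs p X Y lX lY) (lc! termEats)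
                    (lc-⌜⌝T a) (lc-⌜⌝T (a [ i ≔ β ]T)) (lc-⌜⌝T b) (lc-⌜⌝T (b [ i ≔ β ]T))
            (∧-intro (mem-setOf (∈-map⁺ pairOf (subterms-trans t s∈ (subterms-eatsˡ a b))) les)
            (∧-intro (mem-setOf (∈-map⁺ pairOf (subterms-trans t s∈ (subterms-eatsʳ a b))) les)
            (∧-intro (eq-refl X lX) (eq-refl Y lY))))))
        (lstep p X Y lX lY)
        where
          X  = ⌜ eats a b ⌝T
          Y  = image (eats a b)
          lX = lc-⌜⌝T (eats a b)
          lY = lc-⌜⌝T (eats a b [ i ≔ β ]T)

  formAtomic : (Tm → Tm → Tm) → Fm
  formAtomic q = eq (v 6) (q (v 8) (v 10)) ∧F eq (v 7) (q (v 9) (v 11))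
                 ∧F SubstTermP 12 (v 0) (v 3) (v 8) (v 9) ∧F SubstTermP 12 (v 0) (v 3) (v 10) (v 11)

  formDisj formNeg formEx formStep : Fm
  formDisj = mem (hpair (v 8) (v 9)) (v 4) ∧F mem (hpair (v 10) (v 11)) (v 4)
             ∧F eq (v 6) (qDisj (v 8) (v 10)) ∧F eq (v 7) (qDisj (v 9) (v 11))
  formNeg  = mem (hpair (v 8) (v 9)) (v 4) ∧F eq (v 6) (qNeg (v 8)) ∧F eq (v 7) (qNeg (v 9))
  formEx   = mem (hpair (v 8) (v 9)) (v 4) ∧F eq (v 6) (qEx (v 8)) ∧F eq (v 7) (qEx (v 9))
  formStep = exN 8 (exN 9 (exN 10 (exN 11 (formAtomic qMem))))
          ∨F exN 8 (exN 9 (exN 10 (exN 11 (formAtomic qEq))))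
          ∨F exN 8 (exN 9 (exN 10 (exN 11 formDisj)))
          ∨F exN 8 (exN 9 formNeg)
          ∨F exN 8 (exN 9 formEx)

  -- The free variables of each SubstTermP conjunct of formAtomic are substituted by closed terms,
  -- so after substitution it is literally the formula proved by SubstTermP-intro.
  SubstFormP-intro : ∀ i β A →
    ⊢ substσF ((((var [ 0 ↦ ⌜ var i ⌝T ]) [ 1 ↦ ⌜ A ⌝F ]) [ 2 ↦ ⌜ A [ i ≔ β ] ⌝F ]) [ 3 ↦ ⌜ β ⌝T ])
              (SubstFormP 4 (v 0) (v 3) (v 1) (v 2))
  SubstFormP-intro i β A =
    pairSet-intro σ 4 (v 1) (v 2) formStep ⌜_⌝F image (subformulas A) lσ tt tt (lc! formStep)
      (∈-map⁺ pairOf (subformulas-refl A)) (λ {B} _ → lc-⌜⌝F B , lc-⌜⌝F (B [ i ≔ β ])) (λ {B} B∈ → step B B∈)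
    where
      image : Fm → Tm
      image B = ⌜ B [ i ≔ β ] ⌝F
      pairOf = λ B → hpair ⌜ B ⌝F (image B)
      σ  = (((var [ 0 ↦ ⌜ var i ⌝T ]) [ 1 ↦ ⌜ A ⌝F ]) [ 2 ↦ image A ]) [ 3 ↦ ⌜ β ⌝T ]
      lσ = LCSubst-upd 3 (LCSubst-upd 2 (LCSubst-upd 1 (LCSubst-upd 0 LCSubst-var (lc-⌜⌝T (var i)))
                          (lc-⌜⌝F A)) (lc-⌜⌝F (A [ i ≔ β ]))) (lc-⌜⌝T β)
      les = lc-pairsOf ⌜_⌝F image (subformulas A) (λ {B} _ → lc-⌜⌝F B , lc-⌜⌝F (B [ i ≔ β ]))
      σs : ℕ → Fm → ℕ → Tm
      σs p B = (((σ [ 4 ↦ setOf (pairsOf ⌜_⌝F image (subformulas A)) ]) [ 5 ↦ var p ]) [ 6 ↦ ⌜ B ⌝F ]) [ 7 ↦ image B ]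
      lσs : ∀ p B → LCSubst (σs p B)
      lσs p B = LCSubst-upd 7 (LCSubst-upd 6 (LCSubst-upd 5 (LCSubst-upd 4 lσ (lc-setOf les)) tt) (lc-⌜⌝F B))
                             (lc-⌜⌝F (B [ i ≔ β ]))
      lstep : ∀ p B → LC (substσF (σs p B) formStep)
      lstep p B = lcS (σs p B) formStep (lσs p B)
      child : ∀ {B C} → B ∈ subformulas A → C ∈ subformulas B → ⊢ mem (pairOf C) (setOf (pairsOf ⌜_⌝F image (subformulas A)))
      child B∈ C∈ = mem-setOf (∈-map⁺ pairOf (subformulas-trans A B∈ C∈)) les
      code-refl : ∀ B → ⊢ eq ⌜ B ⌝F ⌜ B ⌝F
      code-refl B = eq-refl ⌜ B ⌝F (lc-⌜⌝F B)
      image-refl : ∀ B → ⊢ eq (image B) (image B)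
      image-refl B = eq-refl (image B) (lc-⌜⌝F (B [ i ≔ β ]))
      step : ∀ B → B ∈ subformulas A → ∀ p → ⊢ substσF (σs p B) formStep
      step B@(mem t₁ t₂) _ p = ∨-inj₁ (const
          (∃-intro₄ (σs p B) 8 9 10 11 (formAtomic qMem) ⌜ t₁ ⌝T ⌜ t₁ [ i ≔ β ]T ⌝T ⌜ t₂ ⌝T ⌜ t₂ [ i ≔ β ]T ⌝T
                    (lσs p B) (lc! (formAtomic qMem))
                    (lc-⌜⌝T t₁) (lc-⌜⌝T (t₁ [ i ≔ β ]T)) (lc-⌜⌝T t₂) (lc-⌜⌝T (t₂ [ i ≔ β ]T))
            (∧-intro (code-refl B) (∧-intro (image-refl B)
            (∧-intro (SubstTermP-intro i β t₁) (SubstTermP-intro i β t₂)))))) (lstep p B)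
      step B@(eq t₁ t₂) _ p = ∨-inj₂ (∨-inj₁ (const
          (∃-intro₄ (σs p B) 8 9 10 11 (formAtomic qEq) ⌜ t₁ ⌝T ⌜ t₁ [ i ≔ β ]T ⌝T ⌜ t₂ ⌝T ⌜ t₂ [ i ≔ β ]T ⌝T
                    (lσs p B) (lc! (formAtomic qEq))
                    (lc-⌜⌝T t₁) (lc-⌜⌝T (t₁ [ i ≔ β ]T)) (lc-⌜⌝T t₂) (lc-⌜⌝T (t₂ [ i ≔ β ]T))
            (∧-intro (code-refl B) (∧-intro (image-refl B)
            (∧-intro (SubstTermP-intro i β t₁) (SubstTermP-intro i β t₂))))))) (lstep p B)
      step B@(disj B₁ B₂) B∈ p = ∨-inj₂ (∨-inj₂ (∨-inj₁ (const
          (∃-intro₄ (σs p B) 8 9 10 11 formDisj ⌜ B₁ ⌝F (image B₁) ⌜ B₂ ⌝F (image B₂) (lσs p B) (lc! formDisj)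
                    (lc-⌜⌝F B₁) (lc-⌜⌝F (B₁ [ i ≔ β ])) (lc-⌜⌝F B₂) (lc-⌜⌝F (B₂ [ i ≔ β ]))
            (∧-intro (child B∈ (subformulas-disjˡ B₁ B₂)) (∧-intro (child B∈ (subformulas-disjʳ B₁ B₂)) (∧-intro (code-refl B) (image-refl B)))))))) (lstep p B)
      step B@(neg B₁) B∈ p = ∨-inj₂ (∨-inj₂ (∨-inj₂ (∨-inj₁ (const
          (∃-intro₂ (σs p B) 8 9 formNeg ⌜ B₁ ⌝F (image B₁) (lσs p B) (lc! formNeg) (lc-⌜⌝F B₁) (lc-⌜⌝F (B₁ [ i ≔ β ]))
            (∧-intro (child B∈ (subformulas-neg B₁)) (∧-intro (code-refl B) (image-refl B)))))))) (lstep p B)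
      step B@(ex B₁) B∈ p = ∨-inj₂ (∨-inj₂ (∨-inj₂ (∨-inj₂ (const
          (∃-intro₂ (σs p B) 8 9 formEx ⌜ B₁ ⌝F (image B₁) (lσs p B) (lc! formEx) (lc-⌜⌝F B₁) (lc-⌜⌝F (B₁ [ i ≔ β ]))
            (∧-intro (child B∈ (subformulas-ex B₁)) (∧-intro (code-refl B) (image-refl B)))))))) (lstep p B)

  LCSubst-krpσ : ∀ {a b c} → lcT 0 a → lcT 0 b → lcT 0 c → LCSubst (krpσ a b c)
  LCSubst-krpσ la lb lc zero                = la
  LCSubst-krpσ la lb lc (suc zero)          = lb
  LCSubst-krpσ la lb lc (suc (suc zero))    = lc
  LCSubst-krpσ la lb lc (suc (suc (suc n))) = tt

  KRP-intro : ∀ i A → ⊢ KRP ⌜ var i ⌝T ⌜ A ⌝F ⌜ A [ i ≔ ⌜ A ⌝F ] ⌝F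
  KRP-intro i A =
    ∃-intro (krpσ ⌜ var i ⌝T β ⌜ A [ i ≔ β ] ⌝F) 3 body ⌜ β ⌝T
            (LCSubst-krpσ (lc-⌜⌝T (var i)) (lc-⌜⌝F A) (lc-⌜⌝F (A [ i ≔ β ]))) (lc! body) (lc-⌜⌝T β)
      (∧-intro (QuoteP-intro β (Ground-⌜⌝F A)) (SubstFormP-intro i β A))
    where
      β    = ⌜ A ⌝F
      body = QuoteP 4 (v 1) (v 3) ∧F SubstFormP 4 (v 0) (v 3) (v 1) (v 2)

open Calculus using (KRP-intro)

mainTheorem5 : (E : Fm) → Sentence E → TrueHF E →
    (i : ℕ) (A : Fm) → LC A →
    Deriv E ∅ (KRP ⌜ var i ⌝T ⌜ A ⌝F ⌜ A [ i ≔ ⌜ A ⌝F ] ⌝F)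
mainTheorem5 E _ _ i A _ = KRP-intro E i A
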